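{- Let $n\le 10$ be even and $\lambda\ge 2$. Then $HWP(\lambda K_n;T_1,T_2;\alpha',\gamma')$ has a solution for all admissible 2-factor types $T_1,T_2$ for $K_n$ where $T_1$ is bipartite and $T_2$ is not, and all nonnegative integers $\alpha',\gamma'$ with $\alpha'+\gamma'=\lfloor\lambda\frac{n-1}{2}\rfloor$ and $\alpha'\ge\lfloor\lambda/2\rfloor$, except possibly in the following cases: (D6) $n=6$, $T_1=[6]$, $T_2=[3,3]$, $\alpha'<\lambda+\lfloor\lambda/2\rfloor$; (D8) $n=8$, $T_1=[4,4]$, $T_2=[3,5]$, $\alpha'\not\equiv\lfloor\lambda/2\rfloor\pmod 3$.
   Context: $\lambda K_n$: complete multigraph on $n$ vertices with $\lambda$ parallel edges per pair. A 2-factor has type $[c_1,\ldots,c_t]$ if it is a disjoint union of cycles of lengths $c_1,\ldots,c_t$; a type is bipartite if all entries are even; it is admissible for $K_n$ iff its entries are integers $\ge 3$ summing to $n$. A 2-factorization of an $r$-regular graph is a decomposition into $\lfloor r/2\rfloor$ 2-factors plus a single 1-factor if $r$ is odd. $HWP(\mathcal{G};T_1,T_2;\alpha_1,\alpha_2)$, for $\alpha_1+\alpha_2=\lfloor r/2\rfloor$, asks whether $\mathcal{G}$ admits a 2-factorization with exactly $\alpha_1$ 2-factors of type $T_1$ and $\alpha_2$ of type $T_2$; it has a solution if such exists. -}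

module Defs where

open import Data.Nat using (ℕ; zero; suc; _+_; _*_; _∸_; _≤_; _<_; _/_; _%_)
open import Data.Nat.Properties using ()
open import Data.Fin using (Fin)
open import Data.Fin.Properties using (_≟_)
open import Data.Nat.ListAction using (sum)
open import Data.List using (List; []; _∷_; length; map; concat; concatMap; allFin; replicate; _++_)
open import Data.List.Relation.Unary.All using (All)
open import Data.List.Relation.Unary.Any using (Any)
open import Data.List.Relation.Binary.Permutation.Propositional using (_↭_)
open import Data.Nat.Divisibility using (_∣_)
open import Data.Product using (_×_; _,_; Σ; ∃; proj₁; proj₂)
open import Data.Sum using (_⊎_)
open import Data.Bool using (Bool; true; false; _∧_; _∨_)
open import Relation.Nullary using (¬_)
open import Relation.Nullary.Decidable using (⌊_⌋)
open import Relation.Binary.PropositionalEquality using (_≡_; _≢_)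

Even : ℕ → Set
Even m = 2 ∣ m

Odd : ℕ → Set
Odd m = ¬ (2 ∣ m)

-- A 2-factor type: a list of cycle lengths (considered up to permutation).
Type2F : Set
Type2F = List ℕ

Admissible : ℕ → Type2F → Set
Admissible n T = All (3 ≤_) T × sum T ≡ n

Bipartite : Type2F → Set
Bipartite T = All Even T

cycEdges : {A : Set} → List A → List (A × A)
cycEdges {A} [] = []
cycEdges {A} (x ∷ xs) = go (x ∷ xs)
  where
  go : List A → List (A × A)
  go [] = []
  go (y ∷ []) = (y , x) ∷ []
  go (y ∷ z ∷ r) = (y , z) ∷ go (z ∷ r)

record TwoFactor (n : ℕ) : Set where
  field
    cycles   : List (List (Fin n))
    long     : All (λ c → 3 ≤ length c) cycles
    spanning : concat cycles ↭ allFin n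

open TwoFactor public

HasType : {n : ℕ} → TwoFactor n → Type2F → Set
HasType F T = map length (cycles F) ↭ T

edgesOf : {n : ℕ} → TwoFactor n → List (Fin n × Fin n)
edgesOf F = concatMap cycEdges (cycles F)

IsOneFactor : (n : ℕ) → List (Fin n × Fin n) → Set
IsOneFactor n M = concatMap (λ e → proj₁ e ∷ proj₂ e ∷ []) M ↭ allFin n

mult : {n : ℕ} → Fin n → Fin n → List (Fin n × Fin n) → ℕ
mult u v [] = 0
mult u v ((a , b) ∷ es) with ⌊ a ≟ u ⌋ ∧ ⌊ b ≟ v ⌋ ∨ ⌊ a ≟ v ⌋ ∧ ⌊ b ≟ u ⌋
... | true  = suc (mult u v es)
... | false = mult u v es

-- HWP(λK_n; T₁,T₂; α₁,α₂) has a solution: a 2-factorization of the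
-- λ(n-1)-regular multigraph λK_n consisting of α₁ 2-factors of type T₁,
-- α₂ 2-factors of type T₂, plus a single 1-factor iff λ(n-1) is odd
-- (none if it is even), such that every pair of distinct vertices is
-- joined by exactly λ edges in total.
HWP : (lam n : ℕ) → Type2F → Type2F → ℕ → ℕ → Set
HWP lam n T₁ T₂ α₁ α₂ =
  Σ (List (TwoFactor n)) λ F₁ → length F₁ ≡ α₁ × All (λ F → HasType F T₁) F₁ ×
  Σ (List (TwoFactor n)) λ F₂ → length F₂ ≡ α₂ × All (λ F → HasType F T₂) F₂ ×
  Σ (List (Fin n × Fin n)) λ M →
    ((Even (lam * (n ∸ 1)) × M ≡ []) ⊎ (Odd (lam * (n ∸ 1)) × IsOneFactor n M)) ×
    (∀ (u v : Fin n) → u ≢ v →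
       mult u v (concatMap edgesOf F₁ ++ concatMap edgesOf F₂ ++ M) ≡ lam)

module Submission where

-- For even n ≤ 10 the
-- pairs (T₁, T₂) with T₁ bipartite and T₂ not are ([6], [3,3]) for n = 6,
-- ([8] or [4,4], [3,5]) for n = 8 and ([10] or [4,6], [3,7] or [5,5] or
-- [3,3,4]) for n = 10; smaller n have no non-bipartite type.  For each pair
-- we give a finite frame: perfect matchings I, I′ whose union is a 2-factor
-- U of type T₁ and, for M ∈ {I, I′}, 2-factorizations of K_n − M with c + dj
-- factors of type T₁ and dj′ of type T₂ for every j + j′ = m.  One such
-- factorization of K_n − I, one of K_n − I′ and U together form 2K_n;
-- ⌊λ/2⌋ of these, plus for odd λ one more K_n − I and the 1-factor I, solve
-- the HWP on λK_n for every α ≥ ⌊λ/2⌋ + λc with α ≡ ⌊λ/2⌋ + λc (mod d).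
-- All frames have c = 0, d = 1 except for n = 6 (c = 1, giving exception
-- D6) and for ([4,4], [3,5]) (d = 3, giving exception D8).

open import Defs
open import Data.Nat using (ℕ; _+_; _*_; _∸_; _≤_; _<_; _/_; _%_)
open import Data.List using (List; []; _∷_)
open import Data.List.Relation.Binary.Permutation.Propositional using (_↭_)
open import Data.Product using (_×_)
open import Relation.Nullary using (¬_)
open import Relation.Binary.PropositionalEquality using (_≡_; _≢_)

open import Data.Nat using (zero; suc; NonZero; z≤n; s≤s; _≤?_)
import Data.Nat as ℕ
open import Data.Nat.Properties
  using (+-assoc; +-comm; +-identityʳ; *-identityʳ; *-zeroʳ; *-comm; +-cancelˡ-≡; ≮⇒≥;
         m≤m+n; m≤n+m; ≤-refl; ≤-trans; m+n∸m≡n; m+[n∸m]≡n; m≤n⇒∃[o]m+o≡n; *-cancelˡ-≤; *-distribˡ-∸; *-distribʳ-∸)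
open import Data.Nat.DivMod using (n%1≡0; m≡m%n+[m/n]*n; m/n≡1+[m∸n]/n; [m+kn]%n≡m%n; +-distrib-/-∣ʳ; m*n/n≡m)
open import Data.Nat.Divisibility using (_∣_; divides; divides-refl; _∣0; ∣m∣n⇒∣m+n; ∣m+n∣m⇒∣n; n∣m⇒m%n≡0)
open import Data.Nat.ListAction using (sum)
open import Data.Nat.Solver using (module +-*-Solver)
open import Data.Fin using (Fin)
open import Data.Fin.Properties using (_≟_; all?; ≤-decTotalOrder)
open import Data.List using (length; map; concat; concatMap; allFin; _++_; upTo)
open import Data.List.Properties using (length-++; map-++; concat-++; ++-assoc; ≡-dec)
open import Data.List.Relation.Unary.All using (All; []; _∷_)
import Data.List.Relation.Unary.All as All
open import Data.List.Relation.Unary.All.Properties using (++⁺)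
open import Data.List.Relation.Unary.Any using (here; there)
import Data.List.Relation.Unary.Any as Any
open import Data.List.Membership.Propositional using (_∈_)
open import Data.List.Membership.Propositional.Properties using (∈-upTo⁺; ∈-map⁺; ∈-concatMap⁺)
open import Data.List.Relation.Binary.Permutation.Propositional using (↭-refl; ↭-sym; ↭-trans; ↭-reflexive; prep; swap)
import Data.List.Sort.InsertionSort.Base as InsertionSort
import Data.List.Sort.InsertionSort.Properties as InsertionSortₚ
open import Data.Product using (_,_; Σ)
open import Data.Sum using (_⊎_; inj₁; inj₂)
open import Data.Empty using (⊥-elim)
open import Data.Bool using (true; false; _∧_; _∨_)
open import Relation.Nullary using (Dec; ¬?; yes; no)
open import Relation.Nullary.Decidable using (⌊_⌋; True; toWitness; from-yes; _→-dec_)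
open import Relation.Binary.PropositionalEquality using (refl; sym; trans; cong; cong₂; subst; module ≡-Reasoning)
open +-*-Solver using (solve; _:+_; _:*_; _:=_; con)

Edges : ℕ → Set
Edges n = List (Fin n × Fin n)

Covers : {n : ℕ} → ℕ → Edges n → Set
Covers {n} lam es = ∀ (u v : Fin n) → u ≢ v → mult u v es ≡ lam

SameMultigraph : {n : ℕ} → Edges n → Edges n → Set
SameMultigraph {n} es fs = ∀ (u v : Fin n) → u ≢ v → mult u v es ≡ mult u v fs

allEdges : {n : ℕ} → List (TwoFactor n) → Edges n
allEdges = concatMap edgesOf

mult-++ : ∀ {n} (u v : Fin n) (es fs : Edges n) → mult u v (es ++ fs) ≡ mult u v es + mult u v fs
mult-++ u v [] fs = refl
mult-++ u v ((a , b) ∷ es) fs with ⌊ a ≟ u ⌋ ∧ ⌊ b ≟ v ⌋ ∨ ⌊ a ≟ v ⌋ ∧ ⌊ b ≟ u ⌋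
... | true  = cong suc (mult-++ u v es fs)
... | false = mult-++ u v es fs

allEdges-++ : ∀ {n} (Fs Gs : List (TwoFactor n)) → allEdges (Fs ++ Gs) ≡ allEdges Fs ++ allEdges Gs
allEdges-++ Fs Gs = trans (cong concat (map-++ edgesOf Fs Gs)) (sym (concat-++ (map edgesOf Fs) (map edgesOf Gs)))

-- With M empty or a 1-factor this is exactly a solution of the HWP.
record Decomposition (lam n : ℕ) (T₁ T₂ : Type2F) (α γ : ℕ) (M : Edges n) : Set where
  field
    first      : List (TwoFactor n)
    second     : List (TwoFactor n)
    #first     : length first ≡ α
    #second    : length second ≡ γ
    typeFirst  : All (λ F → HasType F T₁) first
    typeSecond : All (λ F → HasType F T₂) second
    covers     : Covers lam (allEdges first ++ allEdges second ++ M)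

open Decomposition

load : ∀ {n} (u v : Fin n) (Fs Gs : List (TwoFactor n)) (M : Edges n) → ℕ
load u v Fs Gs M = mult u v (allEdges Fs ++ allEdges Gs ++ M)

load-split : ∀ {n} (u v : Fin n) Fs Gs (M : Edges n) →
  load u v Fs Gs M ≡ mult u v (allEdges Fs) + (mult u v (allEdges Gs) + mult u v M)
load-split u v Fs Gs M =
  trans (mult-++ u v (allEdges Fs) _) (cong (mult u v (allEdges Fs) +_) (mult-++ u v (allEdges Gs) M))

load-++ : ∀ {n} (u v : Fin n) Fs Gs Fs′ Gs′ (M M′ : Edges n) →
  load u v (Fs ++ Fs′) (Gs ++ Gs′) (M ++ M′) ≡ load u v Fs Gs M + load u v Fs′ Gs′ M′
load-++ u v Fs Gs Fs′ Gs′ M M′ = begin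
  load u v (Fs ++ Fs′) (Gs ++ Gs′) (M ++ M′)
    ≡⟨ load-split u v (Fs ++ Fs′) (Gs ++ Gs′) (M ++ M′) ⟩
  m (allEdges (Fs ++ Fs′)) + (m (allEdges (Gs ++ Gs′)) + m (M ++ M′))
    ≡⟨ cong₂ (λ x y → x + (y + m (M ++ M′))) (cong m (allEdges-++ Fs Fs′)) (cong m (allEdges-++ Gs Gs′)) ⟩
  m (allEdges Fs ++ allEdges Fs′) + (m (allEdges Gs ++ allEdges Gs′) + m (M ++ M′))
    ≡⟨ cong₂ (λ x y → x + (y + m (M ++ M′))) (mult-++ u v (allEdges Fs) _) (mult-++ u v (allEdges Gs) _) ⟩
  (f + f′) + ((g + g′) + m (M ++ M′))
    ≡⟨ cong (λ z → (f + f′) + ((g + g′) + z)) (mult-++ u v M M′) ⟩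
  (f + f′) + ((g + g′) + (m M + m M′))
    ≡⟨ interchange f f′ g g′ (m M) (m M′) ⟩
  (f + (g + m M)) + (f′ + (g′ + m M′))
    ≡⟨ cong₂ _+_ (sym (load-split u v Fs Gs M)) (sym (load-split u v Fs′ Gs′ M′)) ⟩
  load u v Fs Gs M + load u v Fs′ Gs′ M′ ∎
  where
  open ≡-Reasoning
  m = mult u v
  f = m (allEdges Fs)
  f′ = m (allEdges Fs′)
  g = m (allEdges Gs)
  g′ = m (allEdges Gs′)
  interchange : ∀ a a′ b b′ c c′ → (a + a′) + ((b + b′) + (c + c′)) ≡ (a + (b + c)) + (a′ + (b′ + c′))
  interchange = solve 6 (λ a a′ b b′ c c′ →
    (a :+ a′) :+ ((b :+ b′) :+ (c :+ c′)) := (a :+ (b :+ c)) :+ (a′ :+ (b′ :+ c′))) refl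

recount : ∀ {lam n T₁ T₂ α α′ γ γ′} {M : Edges n} → α ≡ α′ → γ ≡ γ′ →
  Decomposition lam n T₁ T₂ α γ M → Decomposition lam n T₁ T₂ α′ γ′ M
recount refl refl D = D

noFactors : ∀ {n T₁ T₂} → Decomposition 0 n T₁ T₂ 0 0 []
noFactors = record { first = [] ; second = [] ; #first = refl ; #second = refl
                   ; typeFirst = [] ; typeSecond = [] ; covers = λ _ _ _ → refl }

union : ∀ {n T₁ T₂ l₁ l₂ α₁ α₂ γ₁ γ₂} {M₁ M₂ : Edges n} →
  Decomposition l₁ n T₁ T₂ α₁ γ₁ M₁ → Decomposition l₂ n T₁ T₂ α₂ γ₂ M₂ →
  Decomposition (l₁ + l₂) n T₁ T₂ (α₁ + α₂) (γ₁ + γ₂) (M₁ ++ M₂)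
union {M₁ = M₁} {M₂} D E = record
  { first = first D ++ first E
  ; second = second D ++ second E
  ; #first = trans (length-++ (first D)) (cong₂ _+_ (#first D) (#first E))
  ; #second = trans (length-++ (second D)) (cong₂ _+_ (#second D) (#second E))
  ; typeFirst = ++⁺ (typeFirst D) (typeFirst E)
  ; typeSecond = ++⁺ (typeSecond D) (typeSecond E)
  ; covers = λ u v u≢v → trans (load-++ u v (first D) (second D) (first E) (second E) M₁ M₂)
                                (cong₂ _+_ (covers D u v u≢v) (covers E u v u≢v))
  }

absorb : ∀ {lam n T₁ T₂ α γ} {M : Edges n} → Decomposition lam n T₁ T₂ α γ M →
  (U : TwoFactor n) → HasType U T₁ → SameMultigraph (edgesOf U) M →
  Decomposition lam n T₁ T₂ (suc α) γ []
absorb {M = M} D U U-type U≈M = record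
  { first = U ∷ first D
  ; second = second D
  ; #first = cong suc (#first D)
  ; #second = #second D
  ; typeFirst = U-type ∷ typeFirst D
  ; typeSecond = typeSecond D
  ; covers = λ u v u≢v → trans (moveU u v u≢v) (covers D u v u≢v)
  }
  where
  moveU : ∀ u v → u ≢ v → load u v (U ∷ first D) (second D) [] ≡ load u v (first D) (second D) M
  moveU u v u≢v = begin
    load u v (U ∷ first D) (second D) []
      ≡⟨ cong (mult u v) (++-assoc (edgesOf U) (allEdges (first D)) _) ⟩
    mult u v (edgesOf U ++ allEdges (first D) ++ allEdges (second D) ++ [])
      ≡⟨ mult-++ u v (edgesOf U) _ ⟩
    mult u v (edgesOf U) + load u v (first D) (second D) []
      ≡⟨ cong₂ _+_ (U≈M u v u≢v) (load-split u v (first D) (second D) []) ⟩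
    mult u v M + (f + (g + 0))
      ≡⟨ rotate (mult u v M) f g ⟩
    f + (g + mult u v M)
      ≡⟨ sym (load-split u v (first D) (second D) M) ⟩
    load u v (first D) (second D) M ∎
    where
    open ≡-Reasoning
    f = mult u v (allEdges (first D))
    g = mult u v (allEdges (second D))
    rotate : ∀ x a b → x + (a + (b + 0)) ≡ a + (b + x)
    rotate = solve 3 (λ x a b → x :+ (a :+ (b :+ con 0)) := a :+ (b :+ x)) refl

toHWP : ∀ {lam n T₁ T₂ α γ} {M : Edges n} → Decomposition lam n T₁ T₂ α γ M →
  (Even (lam * (n ∸ 1)) × M ≡ []) ⊎ (Odd (lam * (n ∸ 1)) × IsOneFactor n M) →
  HWP lam n T₁ T₂ α γ
toHWP {M = M} D parity =
  first D , #first D , typeFirst D , second D , #second D , typeSecond D , M , parity , covers D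

HWP-resp-↭ : ∀ {lam n T₁ T₂ T₁′ T₂′ α γ} → T₁ ↭ T₁′ → T₂ ↭ T₂′ →
  HWP lam n T₁ T₂ α γ → HWP lam n T₁′ T₂′ α γ
HWP-resp-↭ p₁ p₂ (F₁ , l₁ , t₁ , F₂ , l₂ , t₂ , rest) =
  F₁ , l₁ , All.map (λ t → ↭-trans t p₁) t₁ , F₂ , l₂ , All.map (λ t → ↭-trans t p₂) t₂ , rest

odd-2q+1 : ∀ q → Odd (1 + q * 2)
odd-2q+1 q 2∣ with trans (sym ([m+kn]%n≡m%n 1 q 2)) (n∣m⇒m%n≡0 _ 2 2∣)
... | ()

-- Adding an even number 2k preserves parity; needed to run the parity of
-- λ(n − 1) down λ ↦ λ − 2.
even-double : ∀ k → Even (k + k)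
even-double k = divides k (solve 1 (λ k → k :+ k := k :* con 2) refl k)

even-+2k : ∀ k {x} → Even x → Even (k + (k + x))
even-+2k k {x} 2∣x = subst (2 ∣_) (+-assoc k k x) (∣m∣n⇒∣m+n (even-double k) 2∣x)

odd-+2k : ∀ k {x} → Odd x → Odd (k + (k + x))
odd-+2k k {x} odd 2∣ = odd (∣m+n∣m⇒∣n (subst (2 ∣_) (sym (+-assoc k k x)) 2∣) (even-double k))

half-+2 : ∀ l → suc (suc l) / 2 ≡ suc (l / 2)
half-+2 l = m/n≡1+[m∸n]/n {suc (suc l)} {2} (s≤s (s≤s z≤n))

-- ⌊λ(2h + 1)/2⌋ = ⌊λ/2⌋ + λh: the number of 2-factors in a 2-factorization
-- of λK_{2h+2}.
half-odd-multiple : ∀ lam h → (lam * suc (h * 2)) / 2 ≡ lam / 2 + lam * h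
half-odd-multiple lam h = begin
  (lam * suc (h * 2)) / 2       ≡⟨ cong (_/ 2) (expand lam h) ⟩
  (lam + (lam * h) * 2) / 2     ≡⟨ +-distrib-/-∣ʳ lam (divides-refl (lam * h)) ⟩
  lam / 2 + (lam * h) * 2 / 2   ≡⟨ cong (lam / 2 +_) (m*n/n≡m (lam * h) 2) ⟩
  lam / 2 + lam * h             ∎
  where
  open ≡-Reasoning
  expand : ∀ l h → l * suc (h * 2) ≡ l + (l * h) * 2
  expand = solve 2 (λ l h → l :* (con 1 :+ h :* con 2) := l :+ (l :* h) :* con 2) refl

splitSum : ∀ m R J J′ → J + J′ ≡ m + R →
  Σ ℕ λ j → Σ ℕ λ j′ → Σ ℕ λ K → Σ ℕ λ K′ →
    j + j′ ≡ m × K + K′ ≡ R × J ≡ j + K × J′ ≡ j′ + K′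
splitSum zero R J J′ eq = 0 , 0 , J , J′ , refl , eq , refl , refl
splitSum (suc m) R zero J′ eq = 0 , suc m , 0 , R , refl , refl , refl , eq
splitSum (suc m) R (suc J) J′ eq with splitSum m R J J′ (cong ℕ.pred eq)
... | j , j′ , K , K′ , e₁ , e₂ , refl , refl = suc j , j′ , K , K′ , cong suc e₁ , e₂ , refl , refl

complement : ∀ d .{{_ : NonZero d}} J γ N → d * J + γ ≡ d * N →
  Σ ℕ λ J′ → J + J′ ≡ N × γ ≡ d * J′
complement d J γ N eq = N ∸ J , m+[n∸m]≡n J≤N , γ≡
  where
  J≤N : J ≤ N
  J≤N = *-cancelˡ-≤ d (subst (d * J ≤_) eq (m≤m+n (d * J) γ))
  γ≡ : γ ≡ d * (N ∸ J)
  γ≡ = begin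
    γ                   ≡⟨ sym (m+n∸m≡n (d * J) γ) ⟩
    d * J + γ ∸ d * J   ≡⟨ cong (_∸ d * J) eq ⟩
    d * N ∸ d * J       ≡⟨ sym (*-distribˡ-∸ d N J) ⟩
    d * (N ∸ J)         ∎
    where open ≡-Reasoning

congruent⇒∣ : ∀ d .{{_ : NonZero d}} b x → (b + x) % d ≡ b % d → d ∣ x
congruent⇒∣ d b x same = divides ((b + x) / d ∸ b / d) (begin
  x                                   ≡⟨ sym (m+n∸m≡n (b / d * d) x) ⟩
  b / d * d + x ∸ b / d * d           ≡⟨ cong (_∸ b / d * d) quotients ⟩
  (b + x) / d * d ∸ b / d * d         ≡⟨ sym (*-distribʳ-∸ d ((b + x) / d) (b / d)) ⟩
  ((b + x) / d ∸ b / d) * d           ∎)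
  where
  open ≡-Reasoning
  quotients : b / d * d + x ≡ (b + x) / d * d
  quotients = +-cancelˡ-≡ (b % d) _ _ (begin
    b % d + (b / d * d + x)        ≡⟨ sym (+-assoc (b % d) _ x) ⟩
    b % d + b / d * d + x          ≡⟨ cong (_+ x) (sym (m≡m%n+[m/n]*n b d)) ⟩
    b + x                          ≡⟨ m≡m%n+[m/n]*n (b + x) d ⟩
    (b + x) % d + (b + x) / d * d  ≡⟨ cong (_+ (b + x) / d * d) same ⟩
    b % d + (b + x) / d * d        ∎)

Spectrum : (n : ℕ) → Type2F → Type2F → (c d m : ℕ) → Edges n → Set
Spectrum n T₁ T₂ c d m I = ∀ j j′ → j + j′ ≡ m → Decomposition 1 n T₁ T₂ (c + d * j) (d * j′) I

record Frame (n : ℕ) (T₁ T₂ : Type2F) (c d m : ℕ) : Set where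
  field
    I I′      : Edges n
    spectrum  : Spectrum n T₁ T₂ c d m I
    spectrum′ : Spectrum n T₁ T₂ c d m I′
    U         : TwoFactor n
    U-type    : HasType U T₁
    U-split   : SameMultigraph (edgesOf U) (I ++ I′)
    I-perfect : IsOneFactor n I
    order     : n ∸ 1 ≡ suc ((c + d * m) * 2)

module FrameConstruction {n T₁ T₂ c d m} (Fr : Frame n T₁ T₂ c d m) where
  open Frame Fr

  -- K_n − I, K_n − I′ and the factor U ≅ I ∪ I′ together form 2K_n.
  doubled : ∀ {j₁ j₁′ j₂ j₂′} → j₁ + j₁′ ≡ m → j₂ + j₂′ ≡ m →
    Decomposition 2 n T₁ T₂ (suc ((c + d * j₁) + (c + d * j₂))) (d * j₁′ + d * j₂′) []
  doubled e₁ e₂ = absorb (union (spectrum _ _ e₁) (spectrum′ _ _ e₂)) U U-type U-split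

  leftover : ℕ → Edges n
  leftover zero = []
  leftover (suc zero) = I
  leftover (suc (suc l)) = leftover l

  decompose : ∀ lam J J′ → J + J′ ≡ lam * m →
    Decomposition lam n T₁ T₂ (lam / 2 + lam * c + d * J) (d * J′) (leftover lam)
  decompose zero zero zero refl = recount (sym (*-zeroʳ d)) (sym (*-zeroʳ d)) noFactors
  decompose (suc zero) J J′ eq =
    recount (cong (_+ d * J) (sym (+-identityʳ c))) refl (spectrum J J′ (trans eq (+-identityʳ m)))
  decompose (suc (suc l)) J J′ eq with splitSum m (m + l * m) J J′ eq
  ... | j₁ , j₁′ , K , K′ , e₁ , e , refl , refl with splitSum m (l * m) K K′ e
  ... | j₂ , j₂′ , L , L′ , e₂ , e′ , refl , refl =
    recount countT₁ (countT₂ d j₁′ j₂′ L′) (union (doubled e₁ e₂) (decompose l L L′ e′))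
    where
    regroup : ∀ x c d j₁ j₂ L l →
      suc ((c + d * j₁) + (c + d * j₂)) + (x + l * c + d * L) ≡ suc x + (2 + l) * c + d * (j₁ + (j₂ + L))
    regroup = solve 7 (λ x c d j₁ j₂ L l →
      con 1 :+ ((c :+ d :* j₁) :+ (c :+ d :* j₂)) :+ (x :+ l :* c :+ d :* L)
        := (con 1 :+ x) :+ (con 2 :+ l) :* c :+ d :* (j₁ :+ (j₂ :+ L))) refl
    countT₁ : suc ((c + d * j₁) + (c + d * j₂)) + (l / 2 + l * c + d * L)
            ≡ suc (suc l) / 2 + suc (suc l) * c + d * (j₁ + (j₂ + L))
    countT₁ = trans (regroup (l / 2) c d j₁ j₂ L l)
                    (cong (λ h → h + suc (suc l) * c + d * (j₁ + (j₂ + L))) (sym (half-+2 l)))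
    countT₂ : ∀ d a b r → (d * a + d * b) + d * r ≡ d * (a + (b + r))
    countT₂ = solve 4 (λ d a b r → (d :* a :+ d :* b) :+ d :* r := d :* (a :+ (b :+ r))) refl
  decompose zero zero (suc _) ()
  decompose zero (suc _) _ ()

  leftoverParity : ∀ lam →
    (Even (lam * (n ∸ 1)) × leftover lam ≡ []) ⊎ (Odd (lam * (n ∸ 1)) × IsOneFactor n (leftover lam))
  leftoverParity zero = inj₁ (2 ∣0 , refl)
  leftoverParity (suc zero) = inj₂ (odd , I-perfect)
    where
    odd : Odd (1 * (n ∸ 1))
    odd 2∣ = odd-2q+1 (c + d * m) (subst (2 ∣_) (trans (+-identityʳ (n ∸ 1)) order) 2∣)
  leftoverParity (suc (suc l)) with leftoverParity l
  ... | inj₁ (even , none) = inj₁ (even-+2k (n ∸ 1) even , none)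
  ... | inj₂ (odd , perfect) = inj₂ (odd-+2k (n ∸ 1) odd , perfect)

frameCount : ∀ {n T₁ T₂ c d m} → Frame n T₁ T₂ c d m →
  ∀ lam → (lam * (n ∸ 1)) / 2 ≡ lam / 2 + lam * c + d * (lam * m)
frameCount {n} {c = c} {d = d} {m = m} Fr lam = begin
  (lam * (n ∸ 1)) / 2                ≡⟨ cong (λ k → (lam * k) / 2) (Frame.order Fr) ⟩
  (lam * suc ((c + d * m) * 2)) / 2  ≡⟨ half-odd-multiple lam (c + d * m) ⟩
  lam / 2 + lam * (c + d * m)        ≡⟨ distribute (lam / 2) lam c d m ⟩
  lam / 2 + lam * c + d * (lam * m)  ∎
  where
  open ≡-Reasoning
  distribute : ∀ x l c d m → x + l * (c + d * m) ≡ x + l * c + d * (l * m)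
  distribute = solve 5 (λ x l c d m → x :+ l :* (c :+ d :* m) := x :+ l :* c :+ d :* (l :* m)) refl

cancelBase : ∀ b d J γ N → b + J * d + γ ≡ b + d * N → d * J + γ ≡ d * N
cancelBase b d J γ N eq = +-cancelˡ-≡ b _ _ (begin
  b + (d * J + γ)  ≡⟨ sym (+-assoc b (d * J) γ) ⟩
  b + d * J + γ    ≡⟨ cong (λ z → b + z + γ) (*-comm d J) ⟩
  b + J * d + γ    ≡⟨ eq ⟩
  b + d * N        ∎)
  where open ≡-Reasoning

hwpFromFrame : ∀ {n T₁ T₂ c d m} → Frame n T₁ T₂ c d m → .{{_ : NonZero d}} →
  ∀ lam α γ → lam / 2 + lam * c ≤ α → α % d ≡ (lam / 2 + lam * c) % d →
  α + γ ≡ (lam * (n ∸ 1)) / 2 → HWP lam n T₁ T₂ α γ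
hwpFromFrame {c = c} {d = d} {m = m} Fr lam α γ base≤α α≡base total
  with x , refl ← m≤n⇒∃[o]m+o≡n base≤α
  with divides-refl J ← congruent⇒∣ d (lam / 2 + lam * c) x α≡base
  with J′ , J+J′≡ , refl ← complement d J γ (lam * m) (cancelBase _ d J γ _ (trans total (frameCount Fr lam)))
  = toHWP (recount (cong (lam / 2 + lam * c +_) (*-comm d J)) refl (decompose lam J J′ J+J′≡))
          (leftoverParity lam)
  where open FrameConstruction Fr

-- All ordered lists of parts ≥ 3 summing to r (with at most f parts; taking
-- f = r gives all of them).  Every admissible type occurs here up to order.
compositions : (f r : ℕ) → List Type2F
compositions f zero = [] ∷ []
compositions zero (suc r) = []
compositions (suc f) (suc r) =
  concatMap (λ x → map (x ∷_) (compositions f (suc r ∸ x))) (map (3 +_) (upTo (suc r ∸ 2)))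

compositions-complete : ∀ f T → All (3 ≤_) T → sum T ≤ f → T ∈ compositions f (sum T)
compositions-complete f [] [] _ = here refl
compositions-complete (suc f) (suc (suc (suc k)) ∷ T) (s≤s (s≤s (s≤s z≤n)) ∷ T≥3) (s≤s ΣT≤f) =
  ∈-concatMap⁺ (λ x → map (x ∷_) (compositions f (suc (suc (suc (k + sum T))) ∸ x)))
    (Any.map (λ { refl → ∈-map⁺ (suc (suc (suc k)) ∷_) tail∈ }) (∈-map⁺ (3 +_) (∈-upTo⁺ (s≤s (m≤m+n k (sum T))))))
  where
  tail∈ : T ∈ compositions f (suc (suc (suc (k + sum T))) ∸ suc (suc (suc k)))
  tail∈ = subst (λ r → T ∈ compositions f r) (sym (m+n∸m≡n k (sum T)))
            (compositions-complete f T T≥3 (≤-trans (m≤n+m (sum T) (suc (suc k))) ΣT≤f))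

admissible-listed : ∀ {n T} → Admissible n T → T ∈ compositions n n
admissible-listed {T = T} (T≥3 , refl) = compositions-complete (sum T) T T≥3 ≤-refl

bipartite-below6 : ∀ n {T} → n < 6 → Even n → T ∈ compositions n n → Bipartite T
bipartite-below6 0 _ _ (here refl) = []
bipartite-below6 1 _ 2∣1 _ = ⊥-elim (odd-2q+1 0 2∣1)
bipartite-below6 2 _ _ ()
bipartite-below6 3 _ 2∣3 _ = ⊥-elim (odd-2q+1 1 2∣3)
bipartite-below6 4 _ _ (here refl) = divides 2 refl ∷ []
bipartite-below6 5 _ 2∣5 _ = ⊥-elim (odd-2q+1 2 2∣5)
bipartite-below6 (suc (suc (suc (suc (suc (suc _)))))) (s≤s (s≤s (s≤s (s≤s (s≤s (s≤s ())))))) _ _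

odd-entry : ∀ {T} q → 1 + q * 2 ∈ T → ¬ Bipartite T
odd-entry q (here refl) (2∣ ∷ _) = odd-2q+1 q 2∣
odd-entry q (there q∈) (_ ∷ bip) = odd-entry q q∈ bip

bipartite6 : ∀ {T} → T ∈ compositions 6 6 → Bipartite T → T ↭ 6 ∷ []
bipartite6 (here refl) bip = ⊥-elim (odd-entry 1 (here refl) bip)
bipartite6 (there (here refl)) _ = ↭-refl

nonBipartite6 : ∀ {T} → T ∈ compositions 6 6 → ¬ Bipartite T → T ↭ 3 ∷ 3 ∷ []
nonBipartite6 (here refl) _ = ↭-refl
nonBipartite6 (there (here refl)) nbip = ⊥-elim (nbip (divides 3 refl ∷ []))

bipartite8 : ∀ {T} → T ∈ compositions 8 8 → Bipartite T → T ↭ 4 ∷ 4 ∷ [] ⊎ T ↭ 8 ∷ []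
bipartite8 (here refl) bip = ⊥-elim (odd-entry 1 (here refl) bip)
bipartite8 (there (here refl)) _ = inj₁ ↭-refl
bipartite8 (there (there (here refl))) bip = ⊥-elim (odd-entry 2 (here refl) bip)
bipartite8 (there (there (there (here refl)))) _ = inj₂ ↭-refl

nonBipartite8 : ∀ {T} → T ∈ compositions 8 8 → ¬ Bipartite T → T ↭ 3 ∷ 5 ∷ []
nonBipartite8 (here refl) _ = ↭-refl
nonBipartite8 (there (here refl)) nbip = ⊥-elim (nbip (divides 2 refl ∷ divides 2 refl ∷ []))
nonBipartite8 (there (there (here refl))) _ = swap 5 3 ↭-refl
nonBipartite8 (there (there (there (here refl)))) nbip = ⊥-elim (nbip (divides 4 refl ∷ []))

bipartite10 : ∀ {T} → T ∈ compositions 10 10 → Bipartite T → T ↭ 4 ∷ 6 ∷ [] ⊎ T ↭ 10 ∷ []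
bipartite10 (here refl) bip = ⊥-elim (odd-entry 1 (here refl) bip)
bipartite10 (there (here refl)) bip = ⊥-elim (odd-entry 1 (here refl) bip)
bipartite10 (there (there (here refl))) bip = ⊥-elim (odd-entry 1 (here refl) bip)
bipartite10 (there (there (there (here refl)))) bip = ⊥-elim (odd-entry 1 (there (here refl)) bip)
bipartite10 (there (there (there (there (here refl))))) _ = inj₁ ↭-refl
bipartite10 (there (there (there (there (there (here refl)))))) bip = ⊥-elim (odd-entry 2 (here refl) bip)
bipartite10 (there (there (there (there (there (there (here refl))))))) _ = inj₁ (swap 6 4 ↭-refl)
bipartite10 (there (there (there (there (there (there (there (here refl)))))))) bip =
  ⊥-elim (odd-entry 3 (here refl) bip)
bipartite10 (there (there (there (there (there (there (there (there (here refl))))))))) _ = inj₂ ↭-refl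

nonBipartite10 : ∀ {T} → T ∈ compositions 10 10 → ¬ Bipartite T →
  T ↭ 3 ∷ 3 ∷ 4 ∷ [] ⊎ T ↭ 3 ∷ 7 ∷ [] ⊎ T ↭ 5 ∷ 5 ∷ []
nonBipartite10 (here refl) _ = inj₁ ↭-refl
nonBipartite10 (there (here refl)) _ = inj₁ (prep 3 (swap 4 3 ↭-refl))
nonBipartite10 (there (there (here refl))) _ = inj₂ (inj₁ ↭-refl)
nonBipartite10 (there (there (there (here refl)))) _ = inj₁ (↭-trans (swap 4 3 ↭-refl) (prep 3 (swap 4 3 ↭-refl)))
nonBipartite10 (there (there (there (there (here refl))))) nbip = ⊥-elim (nbip (divides 2 refl ∷ divides 3 refl ∷ []))
nonBipartite10 (there (there (there (there (there (here refl)))))) _ = inj₂ (inj₂ ↭-refl)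
nonBipartite10 (there (there (there (there (there (there (here refl))))))) nbip =
  ⊥-elim (nbip (divides 3 refl ∷ divides 2 refl ∷ []))
nonBipartite10 (there (there (there (there (there (there (there (here refl)))))))) _ = inj₂ (inj₁ (swap 7 3 ↭-refl))
nonBipartite10 (there (there (there (there (there (there (there (there (here refl))))))))) nbip =
  ⊥-elim (nbip (divides 5 refl ∷ []))

covers? : ∀ {n} lam (es : Edges n) → Dec (Covers lam es)
covers? lam es = all? λ u → all? λ v → ¬? (u ≟ v) →-dec (mult u v es ℕ.≟ lam)

sameMultigraph? : ∀ {n} (es fs : Edges n) → Dec (SameMultigraph es fs)
sameMultigraph? es fs = all? λ u → all? λ v → ¬? (u ≟ v) →-dec (mult u v es ℕ.≟ mult u v fs)

module _ {n : ℕ} where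
  open InsertionSort (≤-decTotalOrder n) using (sort)
  open InsertionSortₚ (≤-decTotalOrder n) using (sort-↭)

  factor : (cs : List (List (Fin n))) →
    {long : True (All.all? (λ c → 3 ≤? length c) cs)} →
    {spans : True (≡-dec _≟_ (sort (concat cs)) (allFin n))} → TwoFactor n
  factor cs {long} {spans} = record
    { cycles = cs
    ; long = toWitness long
    ; spanning = ↭-trans (↭-sym (sort-↭ (concat cs))) (↭-reflexive (toWitness spans)) }

  typed? : (T : Type2F) (Fs : List (TwoFactor n)) → Dec (All (λ F → map length (cycles F) ≡ T) Fs)
  typed? T = All.all? (λ F → ≡-dec ℕ._≟_ (map length (cycles F)) T)

  piece : ∀ {T₁ T₂} (M : Edges n) (Fs Gs : List (TwoFactor n)) →
    {typed₁ : True (typed? T₁ Fs)} → {typed₂ : True (typed? T₂ Gs)} →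
    {cover : True (covers? 1 (allEdges Fs ++ allEdges Gs ++ M))} →
    Decomposition 1 n T₁ T₂ (length Fs) (length Gs) M
  piece M Fs Gs {typed₁} {typed₂} {cover} = record
    { first = Fs ; second = Gs ; #first = refl ; #second = refl
    ; typeFirst = All.map ↭-reflexive (toWitness typed₁)
    ; typeSecond = All.map ↭-reflexive (toWitness typed₂)
    ; covers = toWitness cover }

-- The nine frames, all certificates checked by evaluation.  Inside this
-- module numerals denote vertices in Fin n (via literal overloading, which
-- stays local to the module).
module Frames where
  open import Agda.Builtin.FromNat using (Number; fromNat)
  open import Data.Fin.Literals using () renaming (number to finNumber)
  open import Data.Nat.Literals using () renaming (number to natNumber)
  open import Data.Unit using (⊤; tt)

  instance
    numeralsFin : ∀ {n} → Number (Fin n)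
    numeralsFin {n} = finNumber n
    numeralsℕ : Number ℕ
    numeralsℕ = natNumber
    trivially : ⊤
    trivially = tt

  -- Perfect matchings: pairsN = {01, 23, …}, shiftN = {12, 34, …, (N−1)0};
  -- pairsN ∪ shiftN is the Hamilton cycle 0 1 ⋯ (N−1), while pairs8 ∪
  -- squares8 is two 4-cycles and pairs10 ∪ split10 a 4-cycle and a 6-cycle.
  pairs6 : Edges 6
  pairs6 = (0 , 1) ∷ (2 , 3) ∷ (4 , 5) ∷ []

  shift6 : Edges 6
  shift6 = (1 , 2) ∷ (3 , 4) ∷ (5 , 0) ∷ []

  pairs8 : Edges 8
  pairs8 = (0 , 1) ∷ (2 , 3) ∷ (4 , 5) ∷ (6 , 7) ∷ []

  shift8 : Edges 8
  shift8 = (1 , 2) ∷ (3 , 4) ∷ (5 , 6) ∷ (7 , 0) ∷ []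

  squares8 : Edges 8
  squares8 = (1 , 2) ∷ (3 , 0) ∷ (5 , 6) ∷ (7 , 4) ∷ []

  pairs10 : Edges 10
  pairs10 = (0 , 1) ∷ (2 , 3) ∷ (4 , 5) ∷ (6 , 7) ∷ (8 , 9) ∷ []

  shift10 : Edges 10
  shift10 = (1 , 2) ∷ (3 , 4) ∷ (5 , 6) ∷ (7 , 8) ∷ (9 , 0) ∷ []

  split10 : Edges 10
  split10 = (1 , 2) ∷ (3 , 0) ∷ (5 , 6) ∷ (7 , 8) ∷ (9 , 4) ∷ []

  hamilton6 : TwoFactor 6
  hamilton6 = factor ((0 ∷ 1 ∷ 2 ∷ 3 ∷ 4 ∷ 5 ∷ []) ∷ [])

  hamilton8 : TwoFactor 8
  hamilton8 = factor ((0 ∷ 1 ∷ 2 ∷ 3 ∷ 4 ∷ 5 ∷ 6 ∷ 7 ∷ []) ∷ [])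

  twoSquares8 : TwoFactor 8
  twoSquares8 = factor ((0 ∷ 1 ∷ 2 ∷ 3 ∷ []) ∷ (4 ∷ 5 ∷ 6 ∷ 7 ∷ []) ∷ [])

  hamilton10 : TwoFactor 10
  hamilton10 = factor ((0 ∷ 1 ∷ 2 ∷ 3 ∷ 4 ∷ 5 ∷ 6 ∷ 7 ∷ 8 ∷ 9 ∷ []) ∷ [])

  squareHexagon10 : TwoFactor 10
  squareHexagon10 = factor ((0 ∷ 1 ∷ 2 ∷ 3 ∷ []) ∷ (4 ∷ 5 ∷ 6 ∷ 7 ∷ 8 ∷ 9 ∷ []) ∷ [])

  pairs8-35 : ∀ {T₁} → Decomposition 1 8 T₁ (3 ∷ 5 ∷ []) 0 3 pairs8
  pairs8-35 = piece pairs8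
    []
    ( factor ((7 ∷ 0 ∷ 4 ∷ []) ∷ (6 ∷ 5 ∷ 3 ∷ 1 ∷ 2 ∷ []) ∷ [])
    ∷ factor ((4 ∷ 1 ∷ 6 ∷ []) ∷ (0 ∷ 3 ∷ 7 ∷ 2 ∷ 5 ∷ []) ∷ [])
    ∷ factor ((1 ∷ 5 ∷ 7 ∷ []) ∷ (0 ∷ 2 ∷ 4 ∷ 3 ∷ 6 ∷ []) ∷ [])
    ∷ [])

  pairs10-10 : ∀ {T₂} → Decomposition 1 10 (10 ∷ []) T₂ 4 0 pairs10
  pairs10-10 = piece pairs10
    ( factor ((6 ∷ 2 ∷ 7 ∷ 8 ∷ 3 ∷ 5 ∷ 9 ∷ 1 ∷ 4 ∷ 0 ∷ []) ∷ [])
    ∷ factor ((2 ∷ 8 ∷ 1 ∷ 3 ∷ 7 ∷ 0 ∷ 5 ∷ 6 ∷ 9 ∷ 4 ∷ []) ∷ [])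
    ∷ factor ((3 ∷ 4 ∷ 8 ∷ 0 ∷ 9 ∷ 2 ∷ 5 ∷ 7 ∷ 1 ∷ 6 ∷ []) ∷ [])
    ∷ factor ((0 ∷ 2 ∷ 1 ∷ 5 ∷ 8 ∷ 6 ∷ 4 ∷ 7 ∷ 9 ∷ 3 ∷ []) ∷ [])
    ∷ [])
    []

  shift10-10 : ∀ {T₂} → Decomposition 1 10 (10 ∷ []) T₂ 4 0 shift10
  shift10-10 = piece shift10
    ( factor ((5 ∷ 1 ∷ 0 ∷ 4 ∷ 2 ∷ 6 ∷ 8 ∷ 3 ∷ 9 ∷ 7 ∷ []) ∷ [])
    ∷ factor ((4 ∷ 7 ∷ 3 ∷ 1 ∷ 8 ∷ 2 ∷ 0 ∷ 5 ∷ 9 ∷ 6 ∷ []) ∷ [])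
    ∷ factor ((6 ∷ 0 ∷ 7 ∷ 2 ∷ 3 ∷ 5 ∷ 8 ∷ 4 ∷ 9 ∷ 1 ∷ []) ∷ [])
    ∷ factor ((0 ∷ 3 ∷ 6 ∷ 7 ∷ 1 ∷ 4 ∷ 5 ∷ 2 ∷ 9 ∷ 8 ∷ []) ∷ [])
    ∷ [])
    []

  pairs10-37 : ∀ {T₁} → Decomposition 1 10 T₁ (3 ∷ 7 ∷ []) 0 4 pairs10
  pairs10-37 = piece pairs10
    []
    ( factor ((7 ∷ 1 ∷ 9 ∷ []) ∷ (3 ∷ 5 ∷ 6 ∷ 4 ∷ 0 ∷ 2 ∷ 8 ∷ []) ∷ [])
    ∷ factor ((7 ∷ 0 ∷ 8 ∷ []) ∷ (9 ∷ 4 ∷ 3 ∷ 1 ∷ 5 ∷ 2 ∷ 6 ∷ []) ∷ [])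
    ∷ factor ((4 ∷ 1 ∷ 8 ∷ []) ∷ (0 ∷ 6 ∷ 3 ∷ 7 ∷ 2 ∷ 9 ∷ 5 ∷ []) ∷ [])
    ∷ factor ((0 ∷ 3 ∷ 9 ∷ []) ∷ (1 ∷ 2 ∷ 4 ∷ 7 ∷ 5 ∷ 8 ∷ 6 ∷ []) ∷ [])
    ∷ [])

  pairs10-55 : ∀ {T₁} → Decomposition 1 10 T₁ (5 ∷ 5 ∷ []) 0 4 pairs10
  pairs10-55 = piece pairs10
    []
    ( factor ((8 ∷ 6 ∷ 4 ∷ 9 ∷ 3 ∷ []) ∷ (2 ∷ 1 ∷ 5 ∷ 0 ∷ 7 ∷ []) ∷ [])
    ∷ factor ((5 ∷ 6 ∷ 0 ∷ 2 ∷ 8 ∷ []) ∷ (1 ∷ 3 ∷ 4 ∷ 7 ∷ 9 ∷ []) ∷ [])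
    ∷ factor ((0 ∷ 4 ∷ 1 ∷ 7 ∷ 8 ∷ []) ∷ (2 ∷ 9 ∷ 6 ∷ 3 ∷ 5 ∷ []) ∷ [])
    ∷ factor ((0 ∷ 3 ∷ 7 ∷ 5 ∷ 9 ∷ []) ∷ (1 ∷ 6 ∷ 2 ∷ 4 ∷ 8 ∷ []) ∷ [])
    ∷ [])

  pairs10-334 : ∀ {T₁} → Decomposition 1 10 T₁ (3 ∷ 3 ∷ 4 ∷ []) 0 4 pairs10
  pairs10-334 = piece pairs10
    []
    ( factor ((5 ∷ 2 ∷ 6 ∷ []) ∷ (4 ∷ 3 ∷ 7 ∷ []) ∷ (8 ∷ 1 ∷ 9 ∷ 0 ∷ []) ∷ [])
    ∷ factor ((2 ∷ 8 ∷ 7 ∷ []) ∷ (3 ∷ 1 ∷ 6 ∷ []) ∷ (9 ∷ 5 ∷ 0 ∷ 4 ∷ []) ∷ [])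
    ∷ factor ((5 ∷ 3 ∷ 8 ∷ []) ∷ (4 ∷ 1 ∷ 2 ∷ []) ∷ (9 ∷ 7 ∷ 0 ∷ 6 ∷ []) ∷ [])
    ∷ factor ((1 ∷ 5 ∷ 7 ∷ []) ∷ (4 ∷ 6 ∷ 8 ∷ []) ∷ (0 ∷ 2 ∷ 9 ∷ 3 ∷ []) ∷ [])
    ∷ [])

  pairs10-46 : ∀ {T₂} → Decomposition 1 10 (4 ∷ 6 ∷ []) T₂ 4 0 pairs10
  pairs10-46 = piece pairs10
    ( factor ((8 ∷ 0 ∷ 9 ∷ 2 ∷ []) ∷ (5 ∷ 6 ∷ 3 ∷ 4 ∷ 1 ∷ 7 ∷ []) ∷ [])
    ∷ factor ((2 ∷ 5 ∷ 3 ∷ 7 ∷ []) ∷ (8 ∷ 1 ∷ 9 ∷ 4 ∷ 0 ∷ 6 ∷ []) ∷ [])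
    ∷ factor ((5 ∷ 1 ∷ 3 ∷ 0 ∷ []) ∷ (6 ∷ 9 ∷ 7 ∷ 8 ∷ 4 ∷ 2 ∷ []) ∷ [])
    ∷ factor ((3 ∷ 8 ∷ 5 ∷ 9 ∷ []) ∷ (0 ∷ 2 ∷ 1 ∷ 6 ∷ 4 ∷ 7 ∷ []) ∷ [])
    ∷ [])
    []

  split10-46 : ∀ {T₂} → Decomposition 1 10 (4 ∷ 6 ∷ []) T₂ 4 0 split10
  split10-46 = piece split10
    ( factor ((5 ∷ 1 ∷ 4 ∷ 2 ∷ []) ∷ (9 ∷ 7 ∷ 3 ∷ 8 ∷ 0 ∷ 6 ∷ []) ∷ [])
    ∷ factor ((7 ∷ 4 ∷ 3 ∷ 5 ∷ []) ∷ (9 ∷ 8 ∷ 1 ∷ 6 ∷ 2 ∷ 0 ∷ []) ∷ [])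
    ∷ factor ((8 ∷ 5 ∷ 4 ∷ 6 ∷ []) ∷ (7 ∷ 0 ∷ 1 ∷ 9 ∷ 3 ∷ 2 ∷ []) ∷ [])
    ∷ factor ((1 ∷ 3 ∷ 6 ∷ 7 ∷ []) ∷ (0 ∷ 4 ∷ 8 ∷ 2 ∷ 9 ∷ 5 ∷ []) ∷ [])
    ∷ [])
    []

  frame6-6-33 : Frame 6 (6 ∷ []) (3 ∷ 3 ∷ []) 1 1 1
  frame6-6-33 = record
    { I = pairs6 ; I′ = shift6 ; spectrum = S ; spectrum′ = S′
    ; U = hamilton6 ; U-type = ↭-refl ; U-split = from-yes (sameMultigraph? (edgesOf hamilton6) (pairs6 ++ shift6))
    ; I-perfect = ↭-refl ; order = refl }
    where
    S : Spectrum 6 (6 ∷ []) (3 ∷ 3 ∷ []) 1 1 1 pairs6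
    S 0 1 refl = piece pairs6
      ( factor ((3 ∷ 5 ∷ 0 ∷ 2 ∷ 4 ∷ 1 ∷ []) ∷ [])
      ∷ [])
      ( factor ((0 ∷ 3 ∷ 4 ∷ []) ∷ (1 ∷ 2 ∷ 5 ∷ []) ∷ [])
      ∷ [])
    S 1 0 refl = piece pairs6
      ( factor ((3 ∷ 5 ∷ 2 ∷ 0 ∷ 4 ∷ 1 ∷ []) ∷ [])
      ∷ factor ((0 ∷ 3 ∷ 4 ∷ 2 ∷ 1 ∷ 5 ∷ []) ∷ [])
      ∷ [])
      []
    S (suc (suc _)) _ ()

    S′ : Spectrum 6 (6 ∷ []) (3 ∷ 3 ∷ []) 1 1 1 shift6
    S′ 0 1 refl = piece shift6
      ( factor ((5 ∷ 2 ∷ 3 ∷ 0 ∷ 1 ∷ 4 ∷ []) ∷ [])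
      ∷ [])
      ( factor ((0 ∷ 2 ∷ 4 ∷ []) ∷ (1 ∷ 3 ∷ 5 ∷ []) ∷ [])
      ∷ [])
    S′ 1 0 refl = piece shift6
      ( factor ((3 ∷ 1 ∷ 4 ∷ 0 ∷ 2 ∷ 5 ∷ []) ∷ [])
      ∷ factor ((0 ∷ 1 ∷ 5 ∷ 4 ∷ 2 ∷ 3 ∷ []) ∷ [])
      ∷ [])
      []
    S′ (suc (suc _)) _ ()

  frame8-8-35 : Frame 8 (8 ∷ []) (3 ∷ 5 ∷ []) 0 1 3
  frame8-8-35 = record
    { I = pairs8 ; I′ = shift8 ; spectrum = S ; spectrum′ = S′
    ; U = hamilton8 ; U-type = ↭-refl ; U-split = from-yes (sameMultigraph? (edgesOf hamilton8) (pairs8 ++ shift8))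
    ; I-perfect = ↭-refl ; order = refl }
    where
    S : Spectrum 8 (8 ∷ []) (3 ∷ 5 ∷ []) 0 1 3 pairs8
    S 0 3 refl = pairs8-35
    S 1 2 refl = piece pairs8
      ( factor ((1 ∷ 2 ∷ 0 ∷ 6 ∷ 3 ∷ 5 ∷ 7 ∷ 4 ∷ []) ∷ [])
      ∷ [])
      ( factor ((4 ∷ 0 ∷ 3 ∷ []) ∷ (5 ∷ 2 ∷ 7 ∷ 1 ∷ 6 ∷ []) ∷ [])
      ∷ factor ((2 ∷ 4 ∷ 6 ∷ []) ∷ (0 ∷ 5 ∷ 1 ∷ 3 ∷ 7 ∷ []) ∷ [])
      ∷ [])
    S 2 1 refl = piece pairs8
      ( factor ((1 ∷ 2 ∷ 5 ∷ 7 ∷ 3 ∷ 4 ∷ 0 ∷ 6 ∷ []) ∷ [])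
      ∷ factor ((1 ∷ 5 ∷ 6 ∷ 4 ∷ 2 ∷ 7 ∷ 0 ∷ 3 ∷ []) ∷ [])
      ∷ [])
      ( factor ((1 ∷ 4 ∷ 7 ∷ []) ∷ (0 ∷ 2 ∷ 6 ∷ 3 ∷ 5 ∷ []) ∷ [])
      ∷ [])
    S 3 0 refl = piece pairs8
      ( factor ((0 ∷ 5 ∷ 2 ∷ 1 ∷ 4 ∷ 6 ∷ 3 ∷ 7 ∷ []) ∷ [])
      ∷ factor ((0 ∷ 6 ∷ 1 ∷ 5 ∷ 3 ∷ 4 ∷ 7 ∷ 2 ∷ []) ∷ [])
      ∷ factor ((0 ∷ 3 ∷ 1 ∷ 7 ∷ 5 ∷ 6 ∷ 2 ∷ 4 ∷ []) ∷ [])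
      ∷ [])
      []
    S (suc (suc (suc (suc _)))) _ ()

    S′ : Spectrum 8 (8 ∷ []) (3 ∷ 5 ∷ []) 0 1 3 shift8
    S′ 0 3 refl = piece shift8
      []
      ( factor ((7 ∷ 1 ∷ 5 ∷ []) ∷ (6 ∷ 4 ∷ 2 ∷ 0 ∷ 3 ∷ []) ∷ [])
      ∷ factor ((3 ∷ 5 ∷ 2 ∷ []) ∷ (7 ∷ 4 ∷ 1 ∷ 0 ∷ 6 ∷ []) ∷ [])
      ∷ factor ((0 ∷ 4 ∷ 5 ∷ []) ∷ (1 ∷ 3 ∷ 7 ∷ 2 ∷ 6 ∷ []) ∷ [])
      ∷ [])
    S′ 1 2 refl = piece shift8
      ( factor ((1 ∷ 5 ∷ 2 ∷ 3 ∷ 6 ∷ 0 ∷ 4 ∷ 7 ∷ []) ∷ [])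
      ∷ [])
      ( factor ((1 ∷ 6 ∷ 4 ∷ []) ∷ (0 ∷ 2 ∷ 7 ∷ 3 ∷ 5 ∷ []) ∷ [])
      ∷ factor ((0 ∷ 1 ∷ 3 ∷ []) ∷ (2 ∷ 4 ∷ 5 ∷ 7 ∷ 6 ∷ []) ∷ [])
      ∷ [])
    S′ 2 1 refl = piece shift8
      ( factor ((6 ∷ 1 ∷ 3 ∷ 5 ∷ 7 ∷ 2 ∷ 0 ∷ 4 ∷ []) ∷ [])
      ∷ factor ((1 ∷ 5 ∷ 4 ∷ 2 ∷ 3 ∷ 7 ∷ 6 ∷ 0 ∷ []) ∷ [])
      ∷ [])
      ( factor ((1 ∷ 4 ∷ 7 ∷ []) ∷ (0 ∷ 3 ∷ 6 ∷ 2 ∷ 5 ∷ []) ∷ [])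
      ∷ [])
    S′ 3 0 refl = piece shift8
      ( factor ((3 ∷ 5 ∷ 4 ∷ 6 ∷ 1 ∷ 7 ∷ 2 ∷ 0 ∷ []) ∷ [])
      ∷ factor ((4 ∷ 1 ∷ 3 ∷ 7 ∷ 5 ∷ 0 ∷ 6 ∷ 2 ∷ []) ∷ [])
      ∷ factor ((0 ∷ 1 ∷ 5 ∷ 2 ∷ 3 ∷ 6 ∷ 7 ∷ 4 ∷ []) ∷ [])
      ∷ [])
      []
    S′ (suc (suc (suc (suc _)))) _ ()

  frame8-44-35 : Frame 8 (4 ∷ 4 ∷ []) (3 ∷ 5 ∷ []) 0 3 1
  frame8-44-35 = record
    { I = pairs8 ; I′ = squares8 ; spectrum = S ; spectrum′ = S′
    ; U = twoSquares8 ; U-type = ↭-refl ; U-split = from-yes (sameMultigraph? (edgesOf twoSquares8) (pairs8 ++ squares8))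
    ; I-perfect = ↭-refl ; order = refl }
    where
    S : Spectrum 8 (4 ∷ 4 ∷ []) (3 ∷ 5 ∷ []) 0 3 1 pairs8
    S 0 1 refl = pairs8-35
    S 1 0 refl = piece pairs8
      ( factor ((2 ∷ 5 ∷ 7 ∷ 1 ∷ []) ∷ (4 ∷ 6 ∷ 0 ∷ 3 ∷ []) ∷ [])
      ∷ factor ((6 ∷ 5 ∷ 1 ∷ 3 ∷ []) ∷ (7 ∷ 4 ∷ 0 ∷ 2 ∷ []) ∷ [])
      ∷ factor ((0 ∷ 5 ∷ 3 ∷ 7 ∷ []) ∷ (1 ∷ 4 ∷ 2 ∷ 6 ∷ []) ∷ [])
      ∷ [])
      []
    S (suc (suc _)) _ ()

    S′ : Spectrum 8 (4 ∷ 4 ∷ []) (3 ∷ 5 ∷ []) 0 3 1 squares8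
    S′ 0 1 refl = piece squares8
      []
      ( factor ((0 ∷ 5 ∷ 2 ∷ []) ∷ (6 ∷ 4 ∷ 1 ∷ 3 ∷ 7 ∷ []) ∷ [])
      ∷ factor ((5 ∷ 4 ∷ 3 ∷ []) ∷ (6 ∷ 2 ∷ 7 ∷ 0 ∷ 1 ∷ []) ∷ [])
      ∷ factor ((1 ∷ 5 ∷ 7 ∷ []) ∷ (0 ∷ 4 ∷ 2 ∷ 3 ∷ 6 ∷ []) ∷ [])
      ∷ [])
    S′ 1 0 refl = piece squares8
      ( factor ((4 ∷ 1 ∷ 7 ∷ 2 ∷ []) ∷ (3 ∷ 6 ∷ 0 ∷ 5 ∷ []) ∷ [])
      ∷ factor ((1 ∷ 5 ∷ 4 ∷ 6 ∷ []) ∷ (0 ∷ 2 ∷ 3 ∷ 7 ∷ []) ∷ [])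
      ∷ factor ((0 ∷ 1 ∷ 3 ∷ 4 ∷ []) ∷ (2 ∷ 5 ∷ 7 ∷ 6 ∷ []) ∷ [])
      ∷ [])
      []
    S′ (suc (suc _)) _ ()

  frame10-10-37 : Frame 10 (10 ∷ []) (3 ∷ 7 ∷ []) 0 1 4
  frame10-10-37 = record
    { I = pairs10 ; I′ = shift10 ; spectrum = S ; spectrum′ = S′
    ; U = hamilton10 ; U-type = ↭-refl ; U-split = from-yes (sameMultigraph? (edgesOf hamilton10) (pairs10 ++ shift10))
    ; I-perfect = ↭-refl ; order = refl }
    where
    S : Spectrum 10 (10 ∷ []) (3 ∷ 7 ∷ []) 0 1 4 pairs10
    S 0 4 refl = pairs10-37
    S 1 3 refl = piece pairs10
      ( factor ((3 ∷ 0 ∷ 5 ∷ 2 ∷ 4 ∷ 9 ∷ 7 ∷ 8 ∷ 6 ∷ 1 ∷ []) ∷ [])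
      ∷ [])
      ( factor ((8 ∷ 4 ∷ 0 ∷ []) ∷ (2 ∷ 7 ∷ 3 ∷ 9 ∷ 1 ∷ 5 ∷ 6 ∷ []) ∷ [])
      ∷ factor ((0 ∷ 2 ∷ 9 ∷ []) ∷ (1 ∷ 4 ∷ 6 ∷ 3 ∷ 8 ∷ 5 ∷ 7 ∷ []) ∷ [])
      ∷ factor ((1 ∷ 2 ∷ 8 ∷ []) ∷ (0 ∷ 6 ∷ 9 ∷ 5 ∷ 3 ∷ 4 ∷ 7 ∷ []) ∷ [])
      ∷ [])
    S 2 2 refl = piece pairs10
      ( factor ((5 ∷ 8 ∷ 0 ∷ 3 ∷ 7 ∷ 9 ∷ 4 ∷ 1 ∷ 6 ∷ 2 ∷ []) ∷ [])
      ∷ factor ((4 ∷ 0 ∷ 7 ∷ 5 ∷ 1 ∷ 8 ∷ 3 ∷ 6 ∷ 9 ∷ 2 ∷ []) ∷ [])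
      ∷ [])
      ( factor ((8 ∷ 7 ∷ 4 ∷ []) ∷ (0 ∷ 6 ∷ 5 ∷ 3 ∷ 9 ∷ 1 ∷ 2 ∷ []) ∷ [])
      ∷ factor ((0 ∷ 5 ∷ 9 ∷ []) ∷ (1 ∷ 3 ∷ 4 ∷ 6 ∷ 8 ∷ 2 ∷ 7 ∷ []) ∷ [])
      ∷ [])
    S 3 1 refl = piece pairs10
      ( factor ((5 ∷ 0 ∷ 4 ∷ 8 ∷ 2 ∷ 1 ∷ 6 ∷ 9 ∷ 3 ∷ 7 ∷ []) ∷ [])
      ∷ factor ((0 ∷ 8 ∷ 6 ∷ 3 ∷ 1 ∷ 5 ∷ 2 ∷ 4 ∷ 9 ∷ 7 ∷ []) ∷ [])
      ∷ factor ((5 ∷ 6 ∷ 0 ∷ 3 ∷ 4 ∷ 1 ∷ 8 ∷ 7 ∷ 2 ∷ 9 ∷ []) ∷ [])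
      ∷ [])
      ( factor ((3 ∷ 5 ∷ 8 ∷ []) ∷ (0 ∷ 2 ∷ 6 ∷ 4 ∷ 7 ∷ 1 ∷ 9 ∷ []) ∷ [])
      ∷ [])
    S 4 0 refl = pairs10-10
    S (suc (suc (suc (suc (suc _))))) _ ()

    S′ : Spectrum 10 (10 ∷ []) (3 ∷ 7 ∷ []) 0 1 4 shift10
    S′ 0 4 refl = piece shift10
      []
      ( factor ((2 ∷ 9 ∷ 6 ∷ []) ∷ (3 ∷ 5 ∷ 8 ∷ 4 ∷ 1 ∷ 7 ∷ 0 ∷ []) ∷ [])
      ∷ factor ((4 ∷ 7 ∷ 9 ∷ []) ∷ (5 ∷ 0 ∷ 2 ∷ 8 ∷ 3 ∷ 6 ∷ 1 ∷ []) ∷ [])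
      ∷ factor ((0 ∷ 4 ∷ 6 ∷ []) ∷ (7 ∷ 5 ∷ 9 ∷ 8 ∷ 1 ∷ 3 ∷ 2 ∷ []) ∷ [])
      ∷ factor ((2 ∷ 4 ∷ 5 ∷ []) ∷ (0 ∷ 1 ∷ 9 ∷ 3 ∷ 7 ∷ 6 ∷ 8 ∷ []) ∷ [])
      ∷ [])
    S′ 1 3 refl = piece shift10
      ( factor ((3 ∷ 1 ∷ 5 ∷ 2 ∷ 0 ∷ 4 ∷ 6 ∷ 7 ∷ 9 ∷ 8 ∷ []) ∷ [])
      ∷ [])
      ( factor ((8 ∷ 4 ∷ 2 ∷ []) ∷ (1 ∷ 9 ∷ 5 ∷ 3 ∷ 7 ∷ 0 ∷ 6 ∷ []) ∷ [])
      ∷ factor ((1 ∷ 7 ∷ 4 ∷ []) ∷ (2 ∷ 3 ∷ 0 ∷ 5 ∷ 8 ∷ 6 ∷ 9 ∷ []) ∷ [])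
      ∷ factor ((0 ∷ 1 ∷ 8 ∷ []) ∷ (2 ∷ 6 ∷ 3 ∷ 9 ∷ 4 ∷ 5 ∷ 7 ∷ []) ∷ [])
      ∷ [])
    S′ 2 2 refl = piece shift10
      ( factor ((9 ∷ 4 ∷ 7 ∷ 5 ∷ 8 ∷ 1 ∷ 3 ∷ 0 ∷ 6 ∷ 2 ∷ []) ∷ [])
      ∷ factor ((2 ∷ 8 ∷ 9 ∷ 6 ∷ 7 ∷ 1 ∷ 4 ∷ 0 ∷ 5 ∷ 3 ∷ []) ∷ [])
      ∷ [])
      ( factor ((1 ∷ 9 ∷ 5 ∷ []) ∷ (2 ∷ 0 ∷ 8 ∷ 4 ∷ 6 ∷ 3 ∷ 7 ∷ []) ∷ [])
      ∷ factor ((2 ∷ 4 ∷ 5 ∷ []) ∷ (0 ∷ 1 ∷ 6 ∷ 8 ∷ 3 ∷ 9 ∷ 7 ∷ []) ∷ [])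
      ∷ [])
    S′ 3 1 refl = piece shift10
      ( factor ((2 ∷ 5 ∷ 4 ∷ 8 ∷ 6 ∷ 9 ∷ 3 ∷ 1 ∷ 7 ∷ 0 ∷ []) ∷ [])
      ∷ factor ((3 ∷ 6 ∷ 1 ∷ 5 ∷ 9 ∷ 4 ∷ 0 ∷ 8 ∷ 2 ∷ 7 ∷ []) ∷ [])
      ∷ factor ((9 ∷ 1 ∷ 0 ∷ 6 ∷ 4 ∷ 7 ∷ 5 ∷ 8 ∷ 3 ∷ 2 ∷ []) ∷ [])
      ∷ [])
      ( factor ((0 ∷ 3 ∷ 5 ∷ []) ∷ (1 ∷ 4 ∷ 2 ∷ 6 ∷ 7 ∷ 9 ∷ 8 ∷ []) ∷ [])
      ∷ [])
    S′ 4 0 refl = shift10-10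
    S′ (suc (suc (suc (suc (suc _))))) _ ()

  frame10-10-55 : Frame 10 (10 ∷ []) (5 ∷ 5 ∷ []) 0 1 4
  frame10-10-55 = record
    { I = pairs10 ; I′ = shift10 ; spectrum = S ; spectrum′ = S′
    ; U = hamilton10 ; U-type = ↭-refl ; U-split = from-yes (sameMultigraph? (edgesOf hamilton10) (pairs10 ++ shift10))
    ; I-perfect = ↭-refl ; order = refl }
    where
    S : Spectrum 10 (10 ∷ []) (5 ∷ 5 ∷ []) 0 1 4 pairs10
    S 0 4 refl = pairs10-55
    S 1 3 refl = piece pairs10
      ( factor ((4 ∷ 2 ∷ 1 ∷ 5 ∷ 3 ∷ 8 ∷ 7 ∷ 9 ∷ 6 ∷ 0 ∷ []) ∷ [])
      ∷ [])
      ( factor ((1 ∷ 4 ∷ 7 ∷ 2 ∷ 6 ∷ []) ∷ (9 ∷ 3 ∷ 0 ∷ 8 ∷ 5 ∷ []) ∷ [])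
      ∷ factor ((3 ∷ 7 ∷ 1 ∷ 9 ∷ 4 ∷ []) ∷ (6 ∷ 5 ∷ 0 ∷ 2 ∷ 8 ∷ []) ∷ [])
      ∷ factor ((0 ∷ 7 ∷ 5 ∷ 2 ∷ 9 ∷ []) ∷ (1 ∷ 3 ∷ 6 ∷ 4 ∷ 8 ∷ []) ∷ [])
      ∷ [])
    S 2 2 refl = piece pairs10
      ( factor ((0 ∷ 5 ∷ 6 ∷ 3 ∷ 1 ∷ 8 ∷ 7 ∷ 4 ∷ 2 ∷ 9 ∷ []) ∷ [])
      ∷ factor ((4 ∷ 8 ∷ 3 ∷ 5 ∷ 9 ∷ 1 ∷ 7 ∷ 2 ∷ 0 ∷ 6 ∷ []) ∷ [])
      ∷ [])
      ( factor ((8 ∷ 2 ∷ 5 ∷ 1 ∷ 6 ∷ []) ∷ (4 ∷ 0 ∷ 7 ∷ 9 ∷ 3 ∷ []) ∷ [])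
      ∷ factor ((0 ∷ 3 ∷ 7 ∷ 5 ∷ 8 ∷ []) ∷ (1 ∷ 2 ∷ 6 ∷ 9 ∷ 4 ∷ []) ∷ [])
      ∷ [])
    S 3 1 refl = piece pairs10
      ( factor ((5 ∷ 9 ∷ 2 ∷ 1 ∷ 8 ∷ 3 ∷ 7 ∷ 0 ∷ 4 ∷ 6 ∷ []) ∷ [])
      ∷ factor ((9 ∷ 7 ∷ 4 ∷ 8 ∷ 6 ∷ 2 ∷ 0 ∷ 3 ∷ 5 ∷ 1 ∷ []) ∷ [])
      ∷ factor ((7 ∷ 1 ∷ 3 ∷ 6 ∷ 0 ∷ 9 ∷ 4 ∷ 2 ∷ 5 ∷ 8 ∷ []) ∷ [])
      ∷ [])
      ( factor ((0 ∷ 5 ∷ 7 ∷ 2 ∷ 8 ∷ []) ∷ (1 ∷ 4 ∷ 3 ∷ 9 ∷ 6 ∷ []) ∷ [])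
      ∷ [])
    S 4 0 refl = pairs10-10
    S (suc (suc (suc (suc (suc _))))) _ ()

    S′ : Spectrum 10 (10 ∷ []) (5 ∷ 5 ∷ []) 0 1 4 shift10
    S′ 0 4 refl = piece shift10
      []
      ( factor ((0 ∷ 4 ∷ 1 ∷ 5 ∷ 2 ∷ []) ∷ (9 ∷ 6 ∷ 8 ∷ 3 ∷ 7 ∷ []) ∷ [])
      ∷ factor ((1 ∷ 3 ∷ 9 ∷ 2 ∷ 7 ∷ []) ∷ (0 ∷ 8 ∷ 5 ∷ 4 ∷ 6 ∷ []) ∷ [])
      ∷ factor ((8 ∷ 4 ∷ 7 ∷ 5 ∷ 9 ∷ []) ∷ (3 ∷ 0 ∷ 1 ∷ 6 ∷ 2 ∷ []) ∷ [])
      ∷ factor ((0 ∷ 5 ∷ 3 ∷ 6 ∷ 7 ∷ []) ∷ (1 ∷ 8 ∷ 2 ∷ 4 ∷ 9 ∷ []) ∷ [])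
      ∷ [])
    S′ 1 3 refl = piece shift10
      ( factor ((0 ∷ 2 ∷ 6 ∷ 3 ∷ 8 ∷ 9 ∷ 1 ∷ 7 ∷ 5 ∷ 4 ∷ []) ∷ [])
      ∷ [])
      ( factor ((2 ∷ 4 ∷ 1 ∷ 3 ∷ 5 ∷ []) ∷ (6 ∷ 9 ∷ 7 ∷ 0 ∷ 8 ∷ []) ∷ [])
      ∷ factor ((3 ∷ 2 ∷ 9 ∷ 4 ∷ 7 ∷ []) ∷ (8 ∷ 5 ∷ 0 ∷ 6 ∷ 1 ∷ []) ∷ [])
      ∷ factor ((0 ∷ 1 ∷ 5 ∷ 9 ∷ 3 ∷ []) ∷ (2 ∷ 7 ∷ 6 ∷ 4 ∷ 8 ∷ []) ∷ [])
      ∷ [])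
    S′ 2 2 refl = piece shift10
      ( factor ((1 ∷ 3 ∷ 6 ∷ 2 ∷ 8 ∷ 5 ∷ 0 ∷ 7 ∷ 4 ∷ 9 ∷ []) ∷ [])
      ∷ factor ((7 ∷ 9 ∷ 6 ∷ 1 ∷ 0 ∷ 8 ∷ 4 ∷ 2 ∷ 5 ∷ 3 ∷ []) ∷ [])
      ∷ [])
      ( factor ((8 ∷ 1 ∷ 4 ∷ 0 ∷ 6 ∷ []) ∷ (3 ∷ 9 ∷ 5 ∷ 7 ∷ 2 ∷ []) ∷ [])
      ∷ factor ((0 ∷ 2 ∷ 9 ∷ 8 ∷ 3 ∷ []) ∷ (1 ∷ 5 ∷ 4 ∷ 6 ∷ 7 ∷ []) ∷ [])
      ∷ [])
    S′ 3 1 refl = piece shift10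
      ( factor ((6 ∷ 2 ∷ 4 ∷ 5 ∷ 0 ∷ 8 ∷ 3 ∷ 1 ∷ 9 ∷ 7 ∷ []) ∷ [])
      ∷ factor ((9 ∷ 5 ∷ 7 ∷ 3 ∷ 2 ∷ 8 ∷ 1 ∷ 0 ∷ 6 ∷ 4 ∷ []) ∷ [])
      ∷ factor ((8 ∷ 6 ∷ 1 ∷ 4 ∷ 0 ∷ 7 ∷ 2 ∷ 5 ∷ 3 ∷ 9 ∷ []) ∷ [])
      ∷ [])
      ( factor ((0 ∷ 2 ∷ 9 ∷ 6 ∷ 3 ∷ []) ∷ (1 ∷ 5 ∷ 8 ∷ 4 ∷ 7 ∷ []) ∷ [])
      ∷ [])
    S′ 4 0 refl = shift10-10
    S′ (suc (suc (suc (suc (suc _))))) _ ()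

  frame10-10-334 : Frame 10 (10 ∷ []) (3 ∷ 3 ∷ 4 ∷ []) 0 1 4
  frame10-10-334 = record
    { I = pairs10 ; I′ = shift10 ; spectrum = S ; spectrum′ = S′
    ; U = hamilton10 ; U-type = ↭-refl ; U-split = from-yes (sameMultigraph? (edgesOf hamilton10) (pairs10 ++ shift10))
    ; I-perfect = ↭-refl ; order = refl }
    where
    S : Spectrum 10 (10 ∷ []) (3 ∷ 3 ∷ 4 ∷ []) 0 1 4 pairs10
    S 0 4 refl = pairs10-334
    S 1 3 refl = piece pairs10
      ( factor ((0 ∷ 8 ∷ 1 ∷ 4 ∷ 7 ∷ 5 ∷ 3 ∷ 9 ∷ 6 ∷ 2 ∷ []) ∷ [])
      ∷ [])
      ( factor ((5 ∷ 0 ∷ 9 ∷ []) ∷ (6 ∷ 4 ∷ 8 ∷ []) ∷ (3 ∷ 7 ∷ 2 ∷ 1 ∷ []) ∷ [])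
      ∷ factor ((9 ∷ 4 ∷ 2 ∷ []) ∷ (5 ∷ 6 ∷ 1 ∷ []) ∷ (7 ∷ 8 ∷ 3 ∷ 0 ∷ []) ∷ [])
      ∷ factor ((1 ∷ 7 ∷ 9 ∷ []) ∷ (2 ∷ 5 ∷ 8 ∷ []) ∷ (0 ∷ 4 ∷ 3 ∷ 6 ∷ []) ∷ [])
      ∷ [])
    S 2 2 refl = piece pairs10
      ( factor ((1 ∷ 9 ∷ 0 ∷ 5 ∷ 6 ∷ 3 ∷ 4 ∷ 8 ∷ 7 ∷ 2 ∷ []) ∷ [])
      ∷ factor ((9 ∷ 6 ∷ 2 ∷ 0 ∷ 8 ∷ 3 ∷ 7 ∷ 4 ∷ 1 ∷ 5 ∷ []) ∷ [])
      ∷ [])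
      ( factor ((1 ∷ 6 ∷ 8 ∷ []) ∷ (2 ∷ 4 ∷ 9 ∷ []) ∷ (7 ∷ 5 ∷ 3 ∷ 0 ∷ []) ∷ [])
      ∷ factor ((0 ∷ 4 ∷ 6 ∷ []) ∷ (2 ∷ 5 ∷ 8 ∷ []) ∷ (1 ∷ 3 ∷ 9 ∷ 7 ∷ []) ∷ [])
      ∷ [])
    S 3 1 refl = piece pairs10
      ( factor ((8 ∷ 4 ∷ 2 ∷ 0 ∷ 3 ∷ 9 ∷ 7 ∷ 5 ∷ 6 ∷ 1 ∷ []) ∷ [])
      ∷ factor ((3 ∷ 7 ∷ 0 ∷ 4 ∷ 1 ∷ 5 ∷ 2 ∷ 9 ∷ 6 ∷ 8 ∷ []) ∷ [])
      ∷ factor ((1 ∷ 3 ∷ 5 ∷ 0 ∷ 6 ∷ 2 ∷ 8 ∷ 7 ∷ 4 ∷ 9 ∷ []) ∷ [])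
      ∷ [])
      ( factor ((1 ∷ 2 ∷ 7 ∷ []) ∷ (3 ∷ 4 ∷ 6 ∷ []) ∷ (0 ∷ 8 ∷ 5 ∷ 9 ∷ []) ∷ [])
      ∷ [])
    S 4 0 refl = pairs10-10
    S (suc (suc (suc (suc (suc _))))) _ ()

    S′ : Spectrum 10 (10 ∷ []) (3 ∷ 3 ∷ 4 ∷ []) 0 1 4 shift10
    S′ 0 4 refl = piece shift10
      []
      ( factor ((0 ∷ 7 ∷ 6 ∷ []) ∷ (2 ∷ 9 ∷ 3 ∷ []) ∷ (1 ∷ 5 ∷ 4 ∷ 8 ∷ []) ∷ [])
      ∷ factor ((5 ∷ 9 ∷ 8 ∷ []) ∷ (0 ∷ 4 ∷ 2 ∷ []) ∷ (6 ∷ 3 ∷ 7 ∷ 1 ∷ []) ∷ [])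
      ∷ factor ((8 ∷ 6 ∷ 2 ∷ []) ∷ (7 ∷ 9 ∷ 4 ∷ []) ∷ (0 ∷ 5 ∷ 3 ∷ 1 ∷ []) ∷ [])
      ∷ factor ((0 ∷ 3 ∷ 8 ∷ []) ∷ (2 ∷ 5 ∷ 7 ∷ []) ∷ (1 ∷ 4 ∷ 6 ∷ 9 ∷ []) ∷ [])
      ∷ [])
    S′ 1 3 refl = piece shift10
      ( factor ((4 ∷ 5 ∷ 3 ∷ 8 ∷ 2 ∷ 7 ∷ 0 ∷ 6 ∷ 1 ∷ 9 ∷ []) ∷ [])
      ∷ [])
      ( factor ((2 ∷ 5 ∷ 9 ∷ []) ∷ (8 ∷ 4 ∷ 0 ∷ []) ∷ (3 ∷ 6 ∷ 7 ∷ 1 ∷ []) ∷ [])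
      ∷ factor ((9 ∷ 7 ∷ 3 ∷ []) ∷ (6 ∷ 2 ∷ 4 ∷ []) ∷ (1 ∷ 8 ∷ 5 ∷ 0 ∷ []) ∷ [])
      ∷ factor ((0 ∷ 2 ∷ 3 ∷ []) ∷ (6 ∷ 8 ∷ 9 ∷ []) ∷ (1 ∷ 4 ∷ 7 ∷ 5 ∷ []) ∷ [])
      ∷ [])
    S′ 2 2 refl = piece shift10
      ( factor ((4 ∷ 8 ∷ 9 ∷ 7 ∷ 3 ∷ 6 ∷ 2 ∷ 0 ∷ 1 ∷ 5 ∷ []) ∷ [])
      ∷ factor ((1 ∷ 3 ∷ 8 ∷ 0 ∷ 7 ∷ 4 ∷ 2 ∷ 5 ∷ 9 ∷ 6 ∷ []) ∷ [])
      ∷ [])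
      ( factor ((9 ∷ 1 ∷ 4 ∷ []) ∷ (3 ∷ 0 ∷ 5 ∷ []) ∷ (8 ∷ 2 ∷ 7 ∷ 6 ∷ []) ∷ [])
      ∷ factor ((0 ∷ 4 ∷ 6 ∷ []) ∷ (2 ∷ 3 ∷ 9 ∷ []) ∷ (1 ∷ 7 ∷ 5 ∷ 8 ∷ []) ∷ [])
      ∷ [])
    S′ 3 1 refl = piece shift10
      ( factor ((6 ∷ 2 ∷ 5 ∷ 9 ∷ 3 ∷ 7 ∷ 1 ∷ 8 ∷ 4 ∷ 0 ∷ []) ∷ [])
      ∷ factor ((5 ∷ 8 ∷ 9 ∷ 1 ∷ 0 ∷ 2 ∷ 3 ∷ 6 ∷ 7 ∷ 4 ∷ []) ∷ [])
      ∷ factor ((3 ∷ 0 ∷ 8 ∷ 2 ∷ 7 ∷ 9 ∷ 6 ∷ 4 ∷ 1 ∷ 5 ∷ []) ∷ [])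
      ∷ [])
      ( factor ((0 ∷ 5 ∷ 7 ∷ []) ∷ (2 ∷ 4 ∷ 9 ∷ []) ∷ (1 ∷ 3 ∷ 8 ∷ 6 ∷ []) ∷ [])
      ∷ [])
    S′ 4 0 refl = shift10-10
    S′ (suc (suc (suc (suc (suc _))))) _ ()

  frame10-46-37 : Frame 10 (4 ∷ 6 ∷ []) (3 ∷ 7 ∷ []) 0 1 4
  frame10-46-37 = record
    { I = pairs10 ; I′ = split10 ; spectrum = S ; spectrum′ = S′
    ; U = squareHexagon10 ; U-type = ↭-refl ; U-split = from-yes (sameMultigraph? (edgesOf squareHexagon10) (pairs10 ++ split10))
    ; I-perfect = ↭-refl ; order = refl }
    where
    S : Spectrum 10 (4 ∷ 6 ∷ []) (3 ∷ 7 ∷ []) 0 1 4 pairs10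
    S 0 4 refl = pairs10-37
    S 1 3 refl = piece pairs10
      ( factor ((9 ∷ 4 ∷ 8 ∷ 1 ∷ []) ∷ (3 ∷ 6 ∷ 5 ∷ 0 ∷ 2 ∷ 7 ∷ []) ∷ [])
      ∷ [])
      ( factor ((1 ∷ 5 ∷ 7 ∷ []) ∷ (3 ∷ 8 ∷ 0 ∷ 6 ∷ 4 ∷ 2 ∷ 9 ∷ []) ∷ [])
      ∷ factor ((8 ∷ 2 ∷ 6 ∷ []) ∷ (0 ∷ 7 ∷ 4 ∷ 1 ∷ 3 ∷ 5 ∷ 9 ∷ []) ∷ [])
      ∷ factor ((0 ∷ 3 ∷ 4 ∷ []) ∷ (1 ∷ 2 ∷ 5 ∷ 8 ∷ 7 ∷ 9 ∷ 6 ∷ []) ∷ [])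
      ∷ [])
    S 2 2 refl = piece pairs10
      ( factor ((3 ∷ 1 ∷ 9 ∷ 6 ∷ []) ∷ (2 ∷ 5 ∷ 0 ∷ 4 ∷ 8 ∷ 7 ∷ []) ∷ [])
      ∷ factor ((2 ∷ 6 ∷ 5 ∷ 9 ∷ []) ∷ (7 ∷ 3 ∷ 0 ∷ 8 ∷ 1 ∷ 4 ∷ []) ∷ [])
      ∷ [])
      ( factor ((8 ∷ 5 ∷ 3 ∷ []) ∷ (7 ∷ 9 ∷ 0 ∷ 6 ∷ 4 ∷ 2 ∷ 1 ∷ []) ∷ [])
      ∷ factor ((3 ∷ 4 ∷ 9 ∷ []) ∷ (0 ∷ 2 ∷ 8 ∷ 6 ∷ 1 ∷ 5 ∷ 7 ∷ []) ∷ [])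
      ∷ [])
    S 3 1 refl = piece pairs10
      ( factor ((2 ∷ 1 ∷ 3 ∷ 0 ∷ []) ∷ (5 ∷ 6 ∷ 8 ∷ 4 ∷ 7 ∷ 9 ∷ []) ∷ [])
      ∷ factor ((5 ∷ 8 ∷ 0 ∷ 7 ∷ []) ∷ (9 ∷ 1 ∷ 4 ∷ 3 ∷ 6 ∷ 2 ∷ []) ∷ [])
      ∷ factor ((2 ∷ 7 ∷ 3 ∷ 8 ∷ []) ∷ (5 ∷ 0 ∷ 4 ∷ 9 ∷ 6 ∷ 1 ∷ []) ∷ [])
      ∷ [])
      ( factor ((1 ∷ 7 ∷ 8 ∷ []) ∷ (0 ∷ 6 ∷ 4 ∷ 2 ∷ 5 ∷ 3 ∷ 9 ∷ []) ∷ [])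
      ∷ [])
    S 4 0 refl = pairs10-46
    S (suc (suc (suc (suc (suc _))))) _ ()

    S′ : Spectrum 10 (4 ∷ 6 ∷ []) (3 ∷ 7 ∷ []) 0 1 4 split10
    S′ 0 4 refl = piece split10
      []
      ( factor ((7 ∷ 6 ∷ 9 ∷ []) ∷ (8 ∷ 0 ∷ 4 ∷ 2 ∷ 5 ∷ 3 ∷ 1 ∷ []) ∷ [])
      ∷ factor ((7 ∷ 1 ∷ 5 ∷ []) ∷ (8 ∷ 9 ∷ 3 ∷ 2 ∷ 0 ∷ 6 ∷ 4 ∷ []) ∷ [])
      ∷ factor ((7 ∷ 4 ∷ 3 ∷ []) ∷ (8 ∷ 5 ∷ 9 ∷ 0 ∷ 1 ∷ 6 ∷ 2 ∷ []) ∷ [])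
      ∷ factor ((3 ∷ 6 ∷ 8 ∷ []) ∷ (0 ∷ 5 ∷ 4 ∷ 1 ∷ 9 ∷ 2 ∷ 7 ∷ []) ∷ [])
      ∷ [])
    S′ 1 3 refl = piece split10
      ( factor ((3 ∷ 2 ∷ 9 ∷ 6 ∷ []) ∷ (4 ∷ 0 ∷ 1 ∷ 8 ∷ 5 ∷ 7 ∷ []) ∷ [])
      ∷ [])
      ( factor ((9 ∷ 5 ∷ 1 ∷ []) ∷ (6 ∷ 0 ∷ 8 ∷ 3 ∷ 7 ∷ 2 ∷ 4 ∷ []) ∷ [])
      ∷ factor ((9 ∷ 7 ∷ 0 ∷ []) ∷ (6 ∷ 1 ∷ 3 ∷ 5 ∷ 4 ∷ 8 ∷ 2 ∷ []) ∷ [])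
      ∷ factor ((0 ∷ 2 ∷ 5 ∷ []) ∷ (1 ∷ 4 ∷ 3 ∷ 9 ∷ 8 ∷ 6 ∷ 7 ∷ []) ∷ [])
      ∷ [])
    S′ 2 2 refl = piece split10
      ( factor ((9 ∷ 5 ∷ 0 ∷ 8 ∷ []) ∷ (2 ∷ 4 ∷ 7 ∷ 6 ∷ 1 ∷ 3 ∷ []) ∷ [])
      ∷ factor ((4 ∷ 1 ∷ 5 ∷ 3 ∷ []) ∷ (6 ∷ 9 ∷ 0 ∷ 7 ∷ 2 ∷ 8 ∷ []) ∷ [])
      ∷ [])
      ( factor ((4 ∷ 0 ∷ 6 ∷ []) ∷ (8 ∷ 1 ∷ 9 ∷ 2 ∷ 5 ∷ 7 ∷ 3 ∷ []) ∷ [])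
      ∷ factor ((4 ∷ 5 ∷ 8 ∷ []) ∷ (0 ∷ 1 ∷ 7 ∷ 9 ∷ 3 ∷ 6 ∷ 2 ∷ []) ∷ [])
      ∷ [])
    S′ 3 1 refl = piece split10
      ( factor ((6 ∷ 7 ∷ 5 ∷ 1 ∷ []) ∷ (2 ∷ 8 ∷ 9 ∷ 3 ∷ 4 ∷ 0 ∷ []) ∷ [])
      ∷ factor ((9 ∷ 2 ∷ 3 ∷ 1 ∷ []) ∷ (6 ∷ 8 ∷ 5 ∷ 4 ∷ 7 ∷ 0 ∷ []) ∷ [])
      ∷ factor ((1 ∷ 0 ∷ 8 ∷ 4 ∷ []) ∷ (3 ∷ 7 ∷ 2 ∷ 5 ∷ 9 ∷ 6 ∷ []) ∷ [])
      ∷ [])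
      ( factor ((2 ∷ 4 ∷ 6 ∷ []) ∷ (0 ∷ 5 ∷ 3 ∷ 8 ∷ 1 ∷ 7 ∷ 9 ∷ []) ∷ [])
      ∷ [])
    S′ 4 0 refl = split10-46
    S′ (suc (suc (suc (suc (suc _))))) _ ()

  frame10-46-55 : Frame 10 (4 ∷ 6 ∷ []) (5 ∷ 5 ∷ []) 0 1 4
  frame10-46-55 = record
    { I = pairs10 ; I′ = split10 ; spectrum = S ; spectrum′ = S′
    ; U = squareHexagon10 ; U-type = ↭-refl ; U-split = from-yes (sameMultigraph? (edgesOf squareHexagon10) (pairs10 ++ split10))
    ; I-perfect = ↭-refl ; order = refl }
    where
    S : Spectrum 10 (4 ∷ 6 ∷ []) (5 ∷ 5 ∷ []) 0 1 4 pairs10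
    S 0 4 refl = pairs10-55
    S 1 3 refl = piece pairs10
      ( factor ((4 ∷ 3 ∷ 6 ∷ 8 ∷ []) ∷ (5 ∷ 0 ∷ 2 ∷ 1 ∷ 9 ∷ 7 ∷ []) ∷ [])
      ∷ [])
      ( factor ((0 ∷ 9 ∷ 4 ∷ 2 ∷ 7 ∷ []) ∷ (8 ∷ 5 ∷ 6 ∷ 1 ∷ 3 ∷ []) ∷ [])
      ∷ factor ((8 ∷ 1 ∷ 5 ∷ 9 ∷ 2 ∷ []) ∷ (6 ∷ 4 ∷ 7 ∷ 3 ∷ 0 ∷ []) ∷ [])
      ∷ factor ((0 ∷ 4 ∷ 1 ∷ 7 ∷ 8 ∷ []) ∷ (2 ∷ 5 ∷ 3 ∷ 9 ∷ 6 ∷ []) ∷ [])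
      ∷ [])
    S 2 2 refl = piece pairs10
      ( factor ((9 ∷ 4 ∷ 1 ∷ 6 ∷ []) ∷ (2 ∷ 7 ∷ 5 ∷ 3 ∷ 0 ∷ 8 ∷ []) ∷ [])
      ∷ factor ((1 ∷ 7 ∷ 8 ∷ 3 ∷ []) ∷ (5 ∷ 0 ∷ 6 ∷ 4 ∷ 2 ∷ 9 ∷ []) ∷ [])
      ∷ [])
      ( factor ((6 ∷ 2 ∷ 5 ∷ 1 ∷ 8 ∷ []) ∷ (7 ∷ 4 ∷ 0 ∷ 9 ∷ 3 ∷ []) ∷ [])
      ∷ factor ((0 ∷ 2 ∷ 1 ∷ 9 ∷ 7 ∷ []) ∷ (3 ∷ 4 ∷ 8 ∷ 5 ∷ 6 ∷ []) ∷ [])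
      ∷ [])
    S 3 1 refl = piece pairs10
      ( factor ((2 ∷ 4 ∷ 0 ∷ 7 ∷ []) ∷ (6 ∷ 8 ∷ 1 ∷ 9 ∷ 3 ∷ 5 ∷ []) ∷ [])
      ∷ factor ((2 ∷ 5 ∷ 0 ∷ 9 ∷ []) ∷ (4 ∷ 6 ∷ 1 ∷ 3 ∷ 7 ∷ 8 ∷ []) ∷ [])
      ∷ factor ((5 ∷ 8 ∷ 2 ∷ 1 ∷ []) ∷ (9 ∷ 6 ∷ 0 ∷ 3 ∷ 4 ∷ 7 ∷ []) ∷ [])
      ∷ [])
      ( factor ((0 ∷ 2 ∷ 6 ∷ 3 ∷ 8 ∷ []) ∷ (1 ∷ 4 ∷ 9 ∷ 5 ∷ 7 ∷ []) ∷ [])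
      ∷ [])
    S 4 0 refl = pairs10-46
    S (suc (suc (suc (suc (suc _))))) _ ()

    S′ : Spectrum 10 (4 ∷ 6 ∷ []) (5 ∷ 5 ∷ []) 0 1 4 split10
    S′ 0 4 refl = piece split10
      []
      ( factor ((7 ∷ 1 ∷ 8 ∷ 0 ∷ 5 ∷ []) ∷ (3 ∷ 4 ∷ 6 ∷ 2 ∷ 9 ∷ []) ∷ [])
      ∷ factor ((0 ∷ 2 ∷ 4 ∷ 7 ∷ 6 ∷ []) ∷ (3 ∷ 5 ∷ 8 ∷ 9 ∷ 1 ∷ []) ∷ [])
      ∷ factor ((5 ∷ 1 ∷ 4 ∷ 0 ∷ 9 ∷ []) ∷ (8 ∷ 6 ∷ 3 ∷ 7 ∷ 2 ∷ []) ∷ [])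
      ∷ factor ((0 ∷ 1 ∷ 6 ∷ 9 ∷ 7 ∷ []) ∷ (2 ∷ 3 ∷ 8 ∷ 4 ∷ 5 ∷ []) ∷ [])
      ∷ [])
    S′ 1 3 refl = piece split10
      ( factor ((3 ∷ 7 ∷ 9 ∷ 6 ∷ []) ∷ (1 ∷ 8 ∷ 2 ∷ 5 ∷ 0 ∷ 4 ∷ []) ∷ [])
      ∷ [])
      ( factor ((6 ∷ 8 ∷ 9 ∷ 0 ∷ 2 ∷ []) ∷ (3 ∷ 1 ∷ 7 ∷ 4 ∷ 5 ∷ []) ∷ [])
      ∷ factor ((5 ∷ 8 ∷ 0 ∷ 1 ∷ 9 ∷ []) ∷ (2 ∷ 3 ∷ 4 ∷ 6 ∷ 7 ∷ []) ∷ [])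
      ∷ factor ((0 ∷ 6 ∷ 1 ∷ 5 ∷ 7 ∷ []) ∷ (2 ∷ 4 ∷ 8 ∷ 3 ∷ 9 ∷ []) ∷ [])
      ∷ [])
    S′ 2 2 refl = piece split10
      ( factor ((6 ∷ 2 ∷ 5 ∷ 3 ∷ []) ∷ (9 ∷ 8 ∷ 1 ∷ 7 ∷ 4 ∷ 0 ∷ []) ∷ [])
      ∷ factor ((1 ∷ 3 ∷ 2 ∷ 0 ∷ []) ∷ (7 ∷ 6 ∷ 4 ∷ 8 ∷ 5 ∷ 9 ∷ []) ∷ [])
      ∷ [])
      ( factor ((8 ∷ 3 ∷ 7 ∷ 0 ∷ 6 ∷ []) ∷ (1 ∷ 5 ∷ 4 ∷ 2 ∷ 9 ∷ []) ∷ [])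
      ∷ factor ((0 ∷ 5 ∷ 7 ∷ 2 ∷ 8 ∷ []) ∷ (1 ∷ 4 ∷ 3 ∷ 9 ∷ 6 ∷ []) ∷ [])
      ∷ [])
    S′ 3 1 refl = piece split10
      ( factor ((9 ∷ 1 ∷ 7 ∷ 3 ∷ []) ∷ (6 ∷ 0 ∷ 8 ∷ 4 ∷ 5 ∷ 2 ∷ []) ∷ [])
      ∷ factor ((9 ∷ 0 ∷ 1 ∷ 5 ∷ []) ∷ (7 ∷ 6 ∷ 8 ∷ 2 ∷ 3 ∷ 4 ∷ []) ∷ [])
      ∷ factor ((7 ∷ 0 ∷ 2 ∷ 9 ∷ []) ∷ (1 ∷ 8 ∷ 5 ∷ 3 ∷ 6 ∷ 4 ∷ []) ∷ [])
      ∷ [])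
      ( factor ((0 ∷ 4 ∷ 2 ∷ 7 ∷ 5 ∷ []) ∷ (1 ∷ 3 ∷ 8 ∷ 9 ∷ 6 ∷ []) ∷ [])
      ∷ [])
    S′ 4 0 refl = split10-46
    S′ (suc (suc (suc (suc (suc _))))) _ ()

  frame10-46-334 : Frame 10 (4 ∷ 6 ∷ []) (3 ∷ 3 ∷ 4 ∷ []) 0 1 4
  frame10-46-334 = record
    { I = pairs10 ; I′ = split10 ; spectrum = S ; spectrum′ = S′
    ; U = squareHexagon10 ; U-type = ↭-refl ; U-split = from-yes (sameMultigraph? (edgesOf squareHexagon10) (pairs10 ++ split10))
    ; I-perfect = ↭-refl ; order = refl }
    where
    S : Spectrum 10 (4 ∷ 6 ∷ []) (3 ∷ 3 ∷ 4 ∷ []) 0 1 4 pairs10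
    S 0 4 refl = pairs10-334
    S 1 3 refl = piece pairs10
      ( factor ((3 ∷ 0 ∷ 2 ∷ 1 ∷ []) ∷ (4 ∷ 9 ∷ 5 ∷ 6 ∷ 8 ∷ 7 ∷ []) ∷ [])
      ∷ [])
      ( factor ((0 ∷ 9 ∷ 6 ∷ []) ∷ (8 ∷ 5 ∷ 2 ∷ []) ∷ (7 ∷ 3 ∷ 4 ∷ 1 ∷ []) ∷ [])
      ∷ factor ((8 ∷ 0 ∷ 4 ∷ []) ∷ (9 ∷ 7 ∷ 2 ∷ []) ∷ (3 ∷ 6 ∷ 1 ∷ 5 ∷ []) ∷ [])
      ∷ factor ((0 ∷ 5 ∷ 7 ∷ []) ∷ (2 ∷ 4 ∷ 6 ∷ []) ∷ (1 ∷ 8 ∷ 3 ∷ 9 ∷ []) ∷ [])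
      ∷ [])
    S 2 2 refl = piece pairs10
      ( factor ((6 ∷ 0 ∷ 4 ∷ 8 ∷ []) ∷ (2 ∷ 7 ∷ 9 ∷ 3 ∷ 1 ∷ 5 ∷ []) ∷ [])
      ∷ factor ((1 ∷ 2 ∷ 4 ∷ 6 ∷ []) ∷ (0 ∷ 3 ∷ 7 ∷ 8 ∷ 5 ∷ 9 ∷ []) ∷ [])
      ∷ [])
      ( factor ((6 ∷ 9 ∷ 2 ∷ []) ∷ (7 ∷ 5 ∷ 0 ∷ []) ∷ (3 ∷ 8 ∷ 1 ∷ 4 ∷ []) ∷ [])
      ∷ factor ((0 ∷ 2 ∷ 8 ∷ []) ∷ (3 ∷ 5 ∷ 6 ∷ []) ∷ (1 ∷ 7 ∷ 4 ∷ 9 ∷ []) ∷ [])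
      ∷ [])
    S 3 1 refl = piece pairs10
      ( factor ((7 ∷ 0 ∷ 8 ∷ 1 ∷ []) ∷ (9 ∷ 2 ∷ 5 ∷ 3 ∷ 4 ∷ 6 ∷ []) ∷ [])
      ∷ factor ((3 ∷ 0 ∷ 5 ∷ 9 ∷ []) ∷ (1 ∷ 6 ∷ 2 ∷ 8 ∷ 7 ∷ 4 ∷ []) ∷ [])
      ∷ factor ((7 ∷ 9 ∷ 1 ∷ 5 ∷ []) ∷ (8 ∷ 3 ∷ 6 ∷ 0 ∷ 2 ∷ 4 ∷ []) ∷ [])
      ∷ [])
      ( factor ((0 ∷ 4 ∷ 9 ∷ []) ∷ (5 ∷ 6 ∷ 8 ∷ []) ∷ (1 ∷ 2 ∷ 7 ∷ 3 ∷ []) ∷ [])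
      ∷ [])
    S 4 0 refl = pairs10-46
    S (suc (suc (suc (suc (suc _))))) _ ()

    S′ : Spectrum 10 (4 ∷ 6 ∷ []) (3 ∷ 3 ∷ 4 ∷ []) 0 1 4 split10
    S′ 0 4 refl = piece split10
      []
      ( factor ((6 ∷ 3 ∷ 7 ∷ []) ∷ (9 ∷ 0 ∷ 8 ∷ []) ∷ (5 ∷ 2 ∷ 4 ∷ 1 ∷ []) ∷ [])
      ∷ factor ((1 ∷ 0 ∷ 6 ∷ []) ∷ (3 ∷ 9 ∷ 2 ∷ []) ∷ (5 ∷ 7 ∷ 4 ∷ 8 ∷ []) ∷ [])
      ∷ factor ((9 ∷ 1 ∷ 7 ∷ []) ∷ (2 ∷ 6 ∷ 8 ∷ []) ∷ (4 ∷ 3 ∷ 5 ∷ 0 ∷ []) ∷ [])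
      ∷ factor ((0 ∷ 2 ∷ 7 ∷ []) ∷ (1 ∷ 3 ∷ 8 ∷ []) ∷ (4 ∷ 5 ∷ 9 ∷ 6 ∷ []) ∷ [])
      ∷ [])
    S′ 1 3 refl = piece split10
      ( factor ((6 ∷ 8 ∷ 5 ∷ 7 ∷ []) ∷ (0 ∷ 4 ∷ 3 ∷ 1 ∷ 9 ∷ 2 ∷ []) ∷ [])
      ∷ [])
      ( factor ((0 ∷ 7 ∷ 9 ∷ []) ∷ (2 ∷ 4 ∷ 8 ∷ []) ∷ (6 ∷ 1 ∷ 5 ∷ 3 ∷ []) ∷ [])
      ∷ factor ((7 ∷ 3 ∷ 2 ∷ []) ∷ (8 ∷ 1 ∷ 0 ∷ []) ∷ (9 ∷ 5 ∷ 4 ∷ 6 ∷ []) ∷ [])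
      ∷ factor ((1 ∷ 4 ∷ 7 ∷ []) ∷ (3 ∷ 8 ∷ 9 ∷ []) ∷ (0 ∷ 5 ∷ 2 ∷ 6 ∷ []) ∷ [])
      ∷ [])
    S′ 2 2 refl = piece split10
      ( factor ((6 ∷ 0 ∷ 1 ∷ 8 ∷ []) ∷ (9 ∷ 3 ∷ 5 ∷ 4 ∷ 2 ∷ 7 ∷ []) ∷ [])
      ∷ factor ((5 ∷ 0 ∷ 9 ∷ 2 ∷ []) ∷ (4 ∷ 8 ∷ 3 ∷ 7 ∷ 1 ∷ 6 ∷ []) ∷ [])
      ∷ [])
      ( factor ((0 ∷ 2 ∷ 8 ∷ []) ∷ (1 ∷ 4 ∷ 3 ∷ []) ∷ (7 ∷ 5 ∷ 9 ∷ 6 ∷ []) ∷ [])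
      ∷ factor ((0 ∷ 4 ∷ 7 ∷ []) ∷ (2 ∷ 3 ∷ 6 ∷ []) ∷ (1 ∷ 5 ∷ 8 ∷ 9 ∷ []) ∷ [])
      ∷ [])
    S′ 3 1 refl = piece split10
      ( factor ((8 ∷ 4 ∷ 6 ∷ 2 ∷ []) ∷ (3 ∷ 9 ∷ 1 ∷ 7 ∷ 0 ∷ 5 ∷ []) ∷ [])
      ∷ factor ((6 ∷ 3 ∷ 4 ∷ 1 ∷ []) ∷ (0 ∷ 2 ∷ 7 ∷ 9 ∷ 5 ∷ 8 ∷ []) ∷ [])
      ∷ factor ((5 ∷ 1 ∷ 0 ∷ 4 ∷ []) ∷ (3 ∷ 7 ∷ 6 ∷ 8 ∷ 9 ∷ 2 ∷ []) ∷ [])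
      ∷ [])
      ( factor ((0 ∷ 6 ∷ 9 ∷ []) ∷ (1 ∷ 3 ∷ 8 ∷ []) ∷ (2 ∷ 4 ∷ 7 ∷ 5 ∷ []) ∷ [])
      ∷ [])
    S′ 4 0 refl = split10-46
    S′ (suc (suc (suc (suc (suc _))))) _ ()

open Frames using (frame6-6-33; frame8-8-35; frame8-44-35; frame10-10-37; frame10-10-55; frame10-10-334;
                   frame10-46-37; frame10-46-55; frame10-46-334)

-- Residues modulo 1 all agree: the congruence condition is void for d = 1.
mod-1 : ∀ a b → a % 1 ≡ b % 1
mod-1 a b = trans (n%1≡0 a) (sym (n%1≡0 b))

base₀ : ∀ lam → lam / 2 ≡ lam / 2 + lam * 0
base₀ lam = sym (trans (cong (lam / 2 +_) (*-zeroʳ lam)) (+-identityʳ (lam / 2)))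

hwpByFrame₀₁ : ∀ {n T₁ T₂ T₁′ T₂′ m} → Frame n T₁′ T₂′ 0 1 m → T₁ ↭ T₁′ → T₂ ↭ T₂′ →
  ∀ lam α γ → lam / 2 ≤ α → α + γ ≡ (lam * (n ∸ 1)) / 2 → HWP lam n T₁ T₂ α γ
hwpByFrame₀₁ Fr p₁ p₂ lam α γ lo total = HWP-resp-↭ (↭-sym p₁) (↭-sym p₂)
  (hwpFromFrame Fr lam α γ (subst (_≤ α) (base₀ lam) lo) (mod-1 α (lam / 2 + lam * 0)) total)

-- n = 6: only ([6], [3,3]), whose frame has c = 1; this is exception (D6).
hwp6 : ∀ lam {T₁ T₂} → T₁ ∈ compositions 6 6 → T₂ ∈ compositions 6 6 → Bipartite T₁ → ¬ Bipartite T₂ →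
  ∀ α γ → α + γ ≡ (lam * 5) / 2 → ¬ (T₁ ↭ 6 ∷ [] × T₂ ↭ 3 ∷ 3 ∷ [] × α < lam + lam / 2) →
  HWP lam 6 T₁ T₂ α γ
hwp6 lam T₁∈ T₂∈ bip nbip α γ total notD6 = HWP-resp-↭ (↭-sym p₁) (↭-sym p₂)
  (hwpFromFrame frame6-6-33 lam α γ (subst (_≤ α) base₁ lo) (mod-1 α (lam / 2 + lam * 1)) total)
  where
  p₁ = bipartite6 T₁∈ bip
  p₂ = nonBipartite6 T₂∈ nbip
  lo : lam + lam / 2 ≤ α
  lo = ≮⇒≥ (λ α< → notD6 (p₁ , p₂ , α<))
  base₁ : lam + lam / 2 ≡ lam / 2 + lam * 1
  base₁ = trans (+-comm lam (lam / 2)) (cong (lam / 2 +_) (sym (*-identityʳ lam)))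

-- n = 8: ([8], [3,5]) has a frame with d = 1, ([4,4], [3,5]) one with d = 3;
-- the latter is exception (D8).
hwp8 : ∀ lam {T₁ T₂} → T₁ ∈ compositions 8 8 → T₂ ∈ compositions 8 8 → Bipartite T₁ → ¬ Bipartite T₂ →
  ∀ α γ → α + γ ≡ (lam * 7) / 2 → lam / 2 ≤ α →
  ¬ (T₁ ↭ 4 ∷ 4 ∷ [] × T₂ ↭ 3 ∷ 5 ∷ [] × α % 3 ≢ (lam / 2) % 3) → HWP lam 8 T₁ T₂ α γ
hwp8 lam T₁∈ T₂∈ bip nbip α γ total lo notD8 with bipartite8 T₁∈ bip | nonBipartite8 T₂∈ nbip
... | inj₂ p₁ | p₂ = hwpByFrame₀₁ frame8-8-35 p₁ p₂ lam α γ lo total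
... | inj₁ p₁ | p₂ with α % 3 ℕ.≟ (lam / 2) % 3
...   | no α≢ = ⊥-elim (notD8 (p₁ , p₂ , α≢))
...   | yes α≡ = HWP-resp-↭ (↭-sym p₁) (↭-sym p₂)
  (hwpFromFrame frame8-44-35 lam α γ (subst (_≤ α) (base₀ lam) lo) (trans α≡ (cong (_% 3) (base₀ lam))) total)

hwp10 : ∀ lam {T₁ T₂} → T₁ ∈ compositions 10 10 → T₂ ∈ compositions 10 10 → Bipartite T₁ → ¬ Bipartite T₂ →
  ∀ α γ → α + γ ≡ (lam * 9) / 2 → lam / 2 ≤ α → HWP lam 10 T₁ T₂ α γ
hwp10 lam T₁∈ T₂∈ bip nbip α γ total lo with bipartite10 T₁∈ bip | nonBipartite10 T₂∈ nbip
... | inj₂ p₁ | inj₂ (inj₁ p₂) = hwpByFrame₀₁ frame10-10-37 p₁ p₂ lam α γ lo total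
... | inj₂ p₁ | inj₂ (inj₂ p₂) = hwpByFrame₀₁ frame10-10-55 p₁ p₂ lam α γ lo total
... | inj₂ p₁ | inj₁ p₂ = hwpByFrame₀₁ frame10-10-334 p₁ p₂ lam α γ lo total
... | inj₁ p₁ | inj₂ (inj₁ p₂) = hwpByFrame₀₁ frame10-46-37 p₁ p₂ lam α γ lo total
... | inj₁ p₁ | inj₂ (inj₂ p₂) = hwpByFrame₀₁ frame10-46-55 p₁ p₂ lam α γ lo total
... | inj₁ p₁ | inj₁ p₂ = hwpByFrame₀₁ frame10-46-334 p₁ p₂ lam α γ lo total

evenUpTo10 : ∀ n → Even n → n ≤ 10 → n < 6 ⊎ n ≡ 6 ⊎ n ≡ 8 ⊎ n ≡ 10
evenUpTo10 0 _ _ = inj₁ (s≤s z≤n)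
evenUpTo10 1 _ _ = inj₁ (s≤s (s≤s z≤n))
evenUpTo10 2 _ _ = inj₁ (s≤s (s≤s (s≤s z≤n)))
evenUpTo10 3 _ _ = inj₁ (s≤s (s≤s (s≤s (s≤s z≤n))))
evenUpTo10 4 _ _ = inj₁ (s≤s (s≤s (s≤s (s≤s (s≤s z≤n)))))
evenUpTo10 5 _ _ = inj₁ (s≤s (s≤s (s≤s (s≤s (s≤s (s≤s z≤n))))))
evenUpTo10 6 _ _ = inj₂ (inj₁ refl)
evenUpTo10 7 2∣7 _ = ⊥-elim (odd-2q+1 3 2∣7)
evenUpTo10 8 _ _ = inj₂ (inj₂ (inj₁ refl))
evenUpTo10 9 2∣9 _ = ⊥-elim (odd-2q+1 4 2∣9)
evenUpTo10 10 _ _ = inj₂ (inj₂ (inj₂ refl))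
evenUpTo10 (suc (suc (suc (suc (suc (suc (suc (suc (suc (suc (suc _))))))))))) _
  (s≤s (s≤s (s≤s (s≤s (s≤s (s≤s (s≤s (s≤s (s≤s (s≤s ()))))))))))

corollary7p5 : (n lam : ℕ) → Even n → n ≤ 10 → 2 ≤ lam →
  (T₁ T₂ : Type2F) → Admissible n T₁ → Admissible n T₂ →
  Bipartite T₁ → ¬ Bipartite T₂ →
  (α′ γ′ : ℕ) → α′ + γ′ ≡ (lam * (n ∸ 1)) / 2 → lam / 2 ≤ α′ →
  ¬ (n ≡ 6 × T₁ ↭ (6 ∷ []) × T₂ ↭ (3 ∷ 3 ∷ []) × α′ < lam + lam / 2) →
  ¬ (n ≡ 8 × T₁ ↭ (4 ∷ 4 ∷ []) × T₂ ↭ (3 ∷ 5 ∷ []) × α′ % 3 ≢ (lam / 2) % 3) →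
  HWP lam n T₁ T₂ α′ γ′
corollary7p5 n lam even n≤10 _ T₁ T₂ adm₁ adm₂ bip nbip α γ total lo notD6 notD8
  with evenUpTo10 n even n≤10
... | inj₁ n<6 = ⊥-elim (nbip (bipartite-below6 n n<6 even (admissible-listed adm₂)))
... | inj₂ (inj₁ refl) = hwp6 lam (admissible-listed adm₁) (admissible-listed adm₂) bip nbip α γ total
  (λ (p₁ , p₂ , α<) → notD6 (refl , p₁ , p₂ , α<))
... | inj₂ (inj₂ (inj₁ refl)) = hwp8 lam (admissible-listed adm₁) (admissible-listed adm₂) bip nbip α γ total lo
  (λ (p₁ , p₂ , α≢) → notD8 (refl , p₁ , p₂ , α≢))
... | inj₂ (inj₂ (inj₂ refl)) = hwp10 lam (admissible-listed adm₁) (admissible-listed adm₂) bip nbip α γ total lo
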